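{- Let $L\ge4$ and $r\ge0$ be integers and $\kappa_1,\kappa_2,\omega_1,\omega_2$ complex numbers. Let $Z_{2r}(\kappa_1,\kappa_2,\omega_1,\omega_2;L)$ be the weight polynomial of Dyck paths of length $2r$ from height $0$ to height $0$ in the strip of height $L$, where down steps starting at heights $1,2,L-1,L$ have weights $\kappa_1,\kappa_2,\omega_2,\omega_1$ respectively, and all other steps have weight $1$. Put $\hat\kappa_i=\kappa_i-1$, $\hat\omega_i=\omega_i-1$ and $$A=1-\hat\kappa_2\rho^{ -2},\quad \overline{A}=1-\hat\kappa_2\rho^{2},$$ $$B=\rho-(\hat\omega_1+\hat\omega_2)\rho^{ -1}-\hat\omega_2\rho^{ -3},\quad \overline{B}=\rho^{ -1}-(\hat\omega_1+\hat\omega_2)\rho-\hat\omega_2\rho^{3},$$ $$C=\rho-(\hat\kappa_1+\hat\kappa_2)\rho^{ -1}-\hat\kappa_2\rho^{ -3},\quad \overline{C}=\rho^{ -1}-(\hat\kappa_1+\hat\kappa_2)\rho-\hat\kappa_2\rho^{3}.$$ Then $$Z_{2r}(\kappa_1,\kappa_2,\omega_1,\omega_2;L)=\mathrm{CT}_\rho\left[(\rho+\rho^{ -1})^{2r}\left(\frac{AB\rho^L-\overline{A}\,\overline{B}\rho^{ -L}}{CB\rho^L-\overline{C}\,\overline{B}\rho^{ -L}}\right)(\rho^{ -1}-\rho)\right].$$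
   Context: A Dyck path of length $n$ in the strip of height $L$ is a sequence $v_0\dots v_n$ of points in $\mathbb{Z}_{\ge0}\times\{0,\dots,L\}$ with $v_i-v_{i-1}\in\{(1,1),(1,-1)\}$; a step is weighted according to the height of its left endpoint, the weight of a path is the product of its step weights, and the weight polynomial is the sum of the weights of all paths of the given length, start and end height. Constant term: for a rational function $f(\rho)$, $\mathrm{CT}_\rho[f]$ is the coefficient of $\rho^0$ in the Laurent expansion $\sum_{n\ge n_0}a_n\rho^n$ ($n_0\in\mathbb{Z}$) of $f$ about $\rho=0$ valid in a punctured disc around the origin. -}

module Defs where

import Level
open import Algebra.Bundles using (CommutativeRing)
open import Data.Nat as ℕ using (ℕ; zero; suc)
open import Data.Integer as ℤ using (ℤ; +_)
open import Data.List using (List; []; _∷_; _++_; map; concatMap; foldr)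
open import Data.Maybe using (Maybe; just; nothing)
import Data.Maybe as Maybe
open import Data.Product using (_×_; _,_; ∃; proj₁; proj₂)
open import Relation.Nullary using (yes; no)

data Step : Set where
  up down : Step

allSteps : ℕ → List (List Step)
allSteps zero = [] ∷ []
allSteps (suc n) = map (up ∷_) (allSteps n) ++ map (down ∷_) (allSteps n)

module _ {c ℓ} (R : CommutativeRing c ℓ) where
  open CommutativeRing R renaming (Carrier to K)

  -- weight of a down step whose left endpoint is at height h
  -- heights 1, 2, L-1, L get κ₁, κ₂, ω₂, ω₁ (distinct heights since L ≥ 4)
  downWeight : (L : ℕ) (κ₁ κ₂ ω₁ ω₂ : K) → ℕ → K
  downWeight L κ₁ κ₂ ω₁ ω₂ h with h ℕ.≟ 1 | h ℕ.≟ 2 | h ℕ.≟ L ℕ.∸ 1 | h ℕ.≟ L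
  ... | yes _ | _     | _     | _     = κ₁
  ... | no _  | yes _ | _     | _     = κ₂
  ... | no _  | no _  | yes _ | _     = ω₂
  ... | no _  | no _  | no _  | yes _ = ω₁
  ... | no _  | no _  | no _  | no _  = 1#

  walk : (L : ℕ) (κ₁ κ₂ ω₁ ω₂ : K) → ℕ → List Step → Maybe K
  walk L κ₁ κ₂ ω₁ ω₂ zero [] = just 1#
  walk L κ₁ κ₂ ω₁ ω₂ (suc h) [] = nothing
  walk L κ₁ κ₂ ω₁ ω₂ h (up ∷ s) with h ℕ.<? L
  ... | yes _ = Maybe.map (1# *_) (walk L κ₁ κ₂ ω₁ ω₂ (suc h) s)
  ... | no _  = nothing
  walk L κ₁ κ₂ ω₁ ω₂ zero (down ∷ s) = nothing
  walk L κ₁ κ₂ ω₁ ω₂ (suc h) (down ∷ s) =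
    Maybe.map (downWeight L κ₁ κ₂ ω₁ ω₂ (suc h) *_) (walk L κ₁ κ₂ ω₁ ω₂ h s)

  Z : (n L : ℕ) (κ₁ κ₂ ω₁ ω₂ : K) → K
  Z n L κ₁ κ₂ ω₁ ω₂ =
    foldr (λ s acc → Maybe.fromMaybe 0# (walk L κ₁ κ₂ ω₁ ω₂ 0 s) + acc) 0# (allSteps n)

  -- Laurent polynomials in ρ: finite formal sums of monomials c ρ^e

  LPoly : Set c
  LPoly = List (ℤ × K)

  mono : ℤ → K → LPoly
  mono e a = (e , a) ∷ []

  X : ℤ → LPoly
  X e = mono e 1#

  _⊕_ : LPoly → LPoly → LPoly
  p ⊕ q = p ++ q

  ⊝_ : LPoly → LPoly
  ⊝ p = map (λ t → proj₁ t , - proj₂ t) p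

  _⊖_ : LPoly → LPoly → LPoly
  p ⊖ q = p ⊕ (⊝ q)

  _⊗_ : LPoly → LPoly → LPoly
  p ⊗ q = concatMap (λ t → map (λ u → proj₁ t ℤ.+ proj₁ u , proj₂ t * proj₂ u) q) p

  pow : LPoly → ℕ → LPoly
  pow p zero = X (+ 0)
  pow p (suc n) = p ⊗ pow p n

  coeffP : LPoly → ℤ → K
  coeffP p n = foldr (λ t acc → f t + acc) 0# p
    where
    f : ℤ × K → K
    f t with proj₁ t ℤ.≟ n
    ... | yes _ = proj₂ t
    ... | no _  = 0#

  Series : Set c
  Series = ℤ → K

  IsLaurentSeries : Series → Set ℓ
  IsLaurentSeries S = ∃ λ n₀ → ∀ n → n ℤ.< n₀ → S n ≈ 0#

  mulCoeff : LPoly → Series → ℤ → K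
  mulCoeff p S n = foldr (λ t acc → proj₂ t * S (n ℤ.- proj₁ t) + acc) 0# p

  -- S is the Laurent expansion of the rational function N / D at ρ = 0
  ExpansionOf : LPoly → LPoly → Series → Set ℓ
  ExpansionOf N D S = IsLaurentSeries S × (∀ n → mulCoeff D S n ≈ coeffP N n)

  -- CT_ρ [N / D] = z : the Laurent expansion of N/D exists and every such
  -- expansion has constant coefficient z
  CTIs : LPoly → LPoly → K → Set (c Level.⊔ ℓ)
  CTIs N D z =
    (∃ λ S → ExpansionOf N D S × S (+ 0) ≈ z) ×
    (∀ S → ExpansionOf N D S → S (+ 0) ≈ z)

  module Thm6 (L : ℕ) (κ₁ κ₂ ω₁ ω₂ : K) where
    κ̂₁ κ̂₂ ω̂₁ ω̂₂ : K
    κ̂₁ = κ₁ - 1#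
    κ̂₂ = κ₂ - 1#
    ω̂₁ = ω₁ - 1#
    ω̂₂ = ω₂ - 1#

    A Ā B B̄ C C̄ : LPoly
    A = X (+ 0) ⊖ mono (ℤ.- + 2) κ̂₂
    Ā = X (+ 0) ⊖ mono (+ 2) κ̂₂
    B = (X (+ 1) ⊖ mono (ℤ.- + 1) (ω̂₁ + ω̂₂)) ⊖ mono (ℤ.- + 3) ω̂₂
    B̄ = (X (ℤ.- + 1) ⊖ mono (+ 1) (ω̂₁ + ω̂₂)) ⊖ mono (+ 3) ω̂₂
    C = (X (+ 1) ⊖ mono (ℤ.- + 1) (κ̂₁ + κ̂₂)) ⊖ mono (ℤ.- + 3) κ̂₂
    C̄ = (X (ℤ.- + 1) ⊖ mono (+ 1) (κ̂₁ + κ̂₂)) ⊖ mono (+ 3) κ̂₂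

    numerator : ℕ → LPoly
    numerator r =
      (pow (X (+ 1) ⊕ X (ℤ.- + 1)) (2 ℕ.* r)
        ⊗ ((A ⊗ (B ⊗ X (+ L))) ⊖ (Ā ⊗ (B̄ ⊗ X (ℤ.- + L)))))
        ⊗ (X (ℤ.- + 1) ⊖ X (+ 1))

    denominator : LPoly
    denominator = (C ⊗ (B ⊗ X (+ L))) ⊖ (C̄ ⊗ (B̄ ⊗ X (ℤ.- + L)))

-- Write x = ρ + ρ⁻¹, M = A B ρᴸ - Ā B̄ ρ⁻ᴸ and D = C B ρᴸ - C̄ B̄ ρ⁻ᴸ. The lowest
-- coefficient of D is -1, so M / D has a unique Laurent expansion F. Let
-- V h = (ρ⁻¹ - ρ) Pₕ(x), where x V h = V (h+1) + d h V (h-1) is the recurrence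
-- of the weighted transfer matrix; away from the walls V h = C̄ ρ⁻ʰ - C ρʰ.
-- Then u n h = CT[xⁿ V h F] obeys the recursion of weighted paths in (n, h),
-- so u n h is the weight of the paths of length n from h down to 0, because
--   * u 0 h = [h = 0] for h ≤ L: F agrees with the expansion of Ā / C̄ below
--     ρ^(2L-2), which exceeds L + 1 exactly when L ≥ 4, and C̄ · Ā / C̄ = Ā;
--   * u n (L+1) = 0: V (L+1) = -D, and CT[xⁿ M] = 0 as xⁿ is symmetric and
--     M antisymmetric under ρ ↦ ρ⁻¹.
-- The theorem is the case u (2r) 0 = CT[x²ʳ (ρ⁻¹ - ρ) F].

module Submission where

open import Algebra.Bundles using (CommutativeRing)
open import Data.Nat as ℕ using (ℕ; zero; suc)

module IntegerCoefficientSolver {c ℓ} (R : CommutativeRing c ℓ) where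

  open import Data.Integer as ℤ using (ℤ; +_; -[1+_])
  import Data.Integer.Properties as ℤ
  import Data.Nat.Properties as ℕ
  open import Data.Sign as Sign using (Sign)
  open import Data.Maybe using (Maybe; just; nothing)
  open import Relation.Nullary using (yes; no)
  open import Relation.Binary.PropositionalEquality as ≡ using (_≡_)
  open import Algebra.Solver.Ring.AlmostCommutativeRing

  open CommutativeRing R renaming (Carrier to K)
  open import Algebra.Properties.Ring ring
  open import Algebra.Properties.Semiring.Mult.TCOptimised semiring
  open import Relation.Binary.Reasoning.Setoid setoid

  -- The optimised _×_ makes ⟦ + 1 ⟧ℤ reduce to 1#, so that the constants the
  -- solver produces match 1# definitionally.
  ⟦_⟧ℤ : ℤ → K
  ⟦ + n ⟧ℤ = n × 1#
  ⟦ -[1+ n ] ⟧ℤ = - (suc n × 1#)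

  private
    x+y-[x+z]≈y-z : ∀ x y z → (x + y) - (x + z) ≈ y - z
    x+y-[x+z]≈y-z x y z = begin
      (x + y) - (x + z)       ≈⟨ +-congˡ (sym (-‿+-comm x z)) ⟩
      (x + y) + (- x + - z)   ≈⟨ +-congʳ (+-comm x y) ⟩
      (y + x) + (- x + - z)   ≈⟨ +-assoc y x _ ⟩
      y + (x + (- x + - z))   ≈⟨ +-congˡ (sym (+-assoc x (- x) (- z))) ⟩
      y + ((x - x) + - z)     ≈⟨ +-congˡ (+-congʳ (-‿inverseʳ x)) ⟩
      y + (0# + - z)          ≈⟨ +-congˡ (+-identityˡ (- z)) ⟩
      y - z                   ∎

  ⊖-homo : ∀ m n → ⟦ m ℤ.⊖ n ⟧ℤ ≈ m × 1# - n × 1#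
  ⊖-homo zero    zero    = sym (-‿inverseʳ 0#)
  ⊖-homo zero    (suc n) = sym (+-identityˡ _)
  ⊖-homo (suc m) zero    = sym (trans (+-congˡ -0#≈0#) (+-identityʳ _))
  ⊖-homo (suc m) (suc n) = begin
    ⟦ suc m ℤ.⊖ suc n ⟧ℤ  ≡⟨ ≡.cong ⟦_⟧ℤ (ℤ.[1+m]⊖[1+n]≡m⊖n m n) ⟩
    ⟦ m ℤ.⊖ n ⟧ℤ          ≈⟨ ⊖-homo m n ⟩
    m × 1# - n × 1#                    ≈⟨ sym (x+y-[x+z]≈y-z 1# _ _) ⟩
    (1# + m × 1#) - (1# + n × 1#)      ≈⟨ +-cong (sym (1+× m 1#)) (-‿cong (sym (1+× n 1#))) ⟩
    suc m × 1# - suc n × 1#            ∎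

  +-homo : ∀ i j → ⟦ i ℤ.+ j ⟧ℤ ≈ ⟦ i ⟧ℤ + ⟦ j ⟧ℤ
  +-homo -[1+ m ] -[1+ n ] = begin
    - (suc (suc m ℕ.+ n) × 1#)            ≡⟨ ≡.cong (λ k → - (suc k × 1#)) (≡.sym (ℕ.+-suc m n)) ⟩
    - ((suc m ℕ.+ suc n) × 1#)            ≈⟨ -‿cong (×-homo-+ 1# (suc m) (suc n)) ⟩
    - (suc m × 1# + suc n × 1#)           ≈⟨ sym (-‿+-comm _ _) ⟩
    - (suc m × 1#) + - (suc n × 1#)       ∎
  +-homo -[1+ m ] (+ n)    = trans (⊖-homo n (suc m)) (+-comm _ _)
  +-homo (+ m)    -[1+ n ] = ⊖-homo m (suc n)
  +-homo (+ m)    (+ n)    = ×-homo-+ 1# m n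

  -‿homo : ∀ i → ⟦ ℤ.- i ⟧ℤ ≈ - ⟦ i ⟧ℤ
  -‿homo (+ zero)  = sym -0#≈0#
  -‿homo (+ suc n) = refl
  -‿homo -[1+ n ]  = sym (-‿involutive _)

  ⟦_⟧s : Sign → K
  ⟦ Sign.+ ⟧s = 1#
  ⟦ Sign.- ⟧s = - 1#

  ◃-homo : ∀ s n → ⟦ s ℤ.◃ n ⟧ℤ ≈ ⟦ s ⟧s * (n × 1#)
  ◃-homo s       zero    = sym (zeroʳ _)
  ◃-homo Sign.+ (suc n) = sym (*-identityˡ _)
  ◃-homo Sign.- (suc n) = sym (-1*x≈-x _)

  sign-abs : ∀ i → ⟦ i ⟧ℤ ≈ ⟦ ℤ.sign i ⟧s * (ℤ.∣ i ∣ × 1#)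
  sign-abs (+ zero)  = sym (zeroʳ _)
  sign-abs (+ suc n) = sym (*-identityˡ _)
  sign-abs -[1+ n ]  = sym (-1*x≈-x _)

  sign-*-homo : ∀ s t → ⟦ s Sign.* t ⟧s ≈ ⟦ s ⟧s * ⟦ t ⟧s
  sign-*-homo Sign.+ t      = sym (*-identityˡ _)
  sign-*-homo Sign.- Sign.+ = sym (*-identityʳ _)
  sign-*-homo Sign.- Sign.- = sym (trans (-1*x≈-x (- 1#)) (-‿involutive 1#))

  *-homo : ∀ i j → ⟦ i ℤ.* j ⟧ℤ ≈ ⟦ i ⟧ℤ * ⟦ j ⟧ℤ
  *-homo i j = begin
    ⟦ (ℤ.sign i Sign.* ℤ.sign j) ℤ.◃ (ℤ.∣ i ∣ ℕ.* ℤ.∣ j ∣) ⟧ℤ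
      ≈⟨ ◃-homo (ℤ.sign i Sign.* ℤ.sign j) (ℤ.∣ i ∣ ℕ.* ℤ.∣ j ∣) ⟩
    ⟦ ℤ.sign i Sign.* ℤ.sign j ⟧s * ((ℤ.∣ i ∣ ℕ.* ℤ.∣ j ∣) × 1#)
      ≈⟨ *-cong (sign-*-homo (ℤ.sign i) (ℤ.sign j)) (×1-homo-* ℤ.∣ i ∣ ℤ.∣ j ∣) ⟩
    (⟦ ℤ.sign i ⟧s * ⟦ ℤ.sign j ⟧s) * ((ℤ.∣ i ∣ × 1#) * (ℤ.∣ j ∣ × 1#))
      ≈⟨ interchange _ _ _ _ ⟩
    (⟦ ℤ.sign i ⟧s * (ℤ.∣ i ∣ × 1#)) * (⟦ ℤ.sign j ⟧s * (ℤ.∣ j ∣ × 1#))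
      ≈⟨ *-cong (sym (sign-abs i)) (sym (sign-abs j)) ⟩
    ⟦ i ⟧ℤ * ⟦ j ⟧ℤ ∎
    where open import Algebra.Properties.CommutativeSemigroup *-commutativeSemigroup using (interchange)

  homomorphism : ℤ.+-*-rawRing -Raw-AlmostCommutative⟶ fromCommutativeRing R
  homomorphism = record
    { ⟦_⟧    = ⟦_⟧ℤ
    ; +-homo = +-homo
    ; *-homo = *-homo
    ; -‿homo = -‿homo
    ; 0-homo = refl
    ; 1-homo = refl
    }

  _≟ℤ_ : ∀ i j → Maybe (⟦ i ⟧ℤ ≈ ⟦ j ⟧ℤ)
  i ≟ℤ j with i ℤ.≟ j
  ... | yes ≡.refl = just refl
  ... | no _       = nothing

  open import Algebra.Solver.Ring ℤ.+-*-rawRing (fromCommutativeRing R) homomorphism _≟ℤ_ public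

module LaurentPolynomials {c ℓ} (R : CommutativeRing c ℓ) where

  import Level
  open import Algebra.Structures using (IsCommutativeRing)
  open import Relation.Binary.Structures using (IsEquivalence)
  import Data.Nat.Properties as ℕ
  open import Data.Integer as ℤ using (ℤ; +_; -[1+_]; _≤_; _<_)
  import Data.Integer.Properties as ℤ
  open import Data.Integer.Tactic.RingSolver using (solve-∀)
  open import Data.List using (List; []; _∷_; _++_; map)
  open import Data.List.Relation.Unary.All as All using (All; []; _∷_)
  import Data.List.Relation.Unary.All.Properties as All
  open import Data.Product using (_,_; ∃; proj₁; proj₂)
  open import Data.Sum using (_⊎_; inj₁; inj₂)
  open import Data.Empty using (⊥-elim)
  open import Function using (_∘_)
  open import Relation.Nullary using (yes; no)
  open import Relation.Binary.PropositionalEquality as ≡ using (_≡_; _≢_)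
  import Defs as D

  open CommutativeRing R renaming (Carrier to K)
  open import Algebra.Properties.Ring ring public
  open import Relation.Binary.Reasoning.Setoid setoid
  module KS = IntegerCoefficientSolver R

  LPoly : Set c
  LPoly = D.LPoly R

  Series : Set c
  Series = D.Series R

  infixl 6 _⊕_ _⊖_
  infixl 7 _⊗_
  infix 8 ⊝_
  infixr 7 _∙_

  _⊕_ _⊖_ _⊗_ : LPoly → LPoly → LPoly
  _⊕_ = D._⊕_ R
  _⊖_ = D._⊖_ R
  _⊗_ = D._⊗_ R

  ⊝_ : LPoly → LPoly
  ⊝_ = D.⊝_ R

  X : ℤ → LPoly
  X = D.X R

  mono : ℤ → K → LPoly
  mono = D.mono R

  coeffP : LPoly → ℤ → K
  coeffP = D.coeffP R

  _∙_ : LPoly → Series → Series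
  _∙_ = D.mulCoeff R

  infix 4 _≈ₛ_
  _≈ₛ_ : Series → Series → Set ℓ
  S ≈ₛ T = ∀ n → S n ≈ T n

  ∙-congʳ : ∀ p {S T} → S ≈ₛ T → p ∙ S ≈ₛ p ∙ T
  ∙-congʳ []            S≈T n = refl
  ∙-congʳ ((e , a) ∷ p) S≈T n = +-cong (*-congˡ (S≈T (n ℤ.- e))) (∙-congʳ p S≈T n)

  ⊕-∙ : ∀ p q S n → ((p ⊕ q) ∙ S) n ≈ (p ∙ S) n + (q ∙ S) n
  ⊕-∙ []            q S n = sym (+-identityˡ _)
  ⊕-∙ ((e , a) ∷ p) q S n = trans (+-congˡ (⊕-∙ p q S n)) (sym (+-assoc _ _ _))

  ⊝-∙ : ∀ p S n → ((⊝ p) ∙ S) n ≈ - (p ∙ S) n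
  ⊝-∙ []            S n = sym -0#≈0#
  ⊝-∙ ((e , a) ∷ p) S n = trans (+-cong (sym (-‿distribˡ-* _ _)) (⊝-∙ p S n)) (-‿+-comm _ _)

  ⊖-∙ : ∀ p q S n → ((p ⊖ q) ∙ S) n ≈ (p ∙ S) n - (q ∙ S) n
  ⊖-∙ p q S n = trans (⊕-∙ p (⊝ q) S n) (+-congˡ (⊝-∙ q S n))

  ∙-+ : ∀ p S T n → (p ∙ (λ m → S m + T m)) n ≈ (p ∙ S) n + (p ∙ T) n
  ∙-+ []            S T n = sym (+-identityˡ _)
  ∙-+ ((e , a) ∷ p) S T n = begin
    a * (S (n ℤ.- e) + T (n ℤ.- e)) + (p ∙ (λ m → S m + T m)) n
      ≈⟨ +-cong (distribˡ _ _ _) (∙-+ p S T n) ⟩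
    (a * S (n ℤ.- e) + a * T (n ℤ.- e)) + ((p ∙ S) n + (p ∙ T) n)
      ≈⟨ KS.solve 4 (λ x y z w → (x :+ y) :+ (z :+ w) := (x :+ z) :+ (y :+ w)) refl _ _ _ _ ⟩
    (a * S (n ℤ.- e) + (p ∙ S) n) + (a * T (n ℤ.- e) + (p ∙ T) n) ∎
    where open KS

  ∙-neg : ∀ p S n → (p ∙ (λ m → - S m)) n ≈ - (p ∙ S) n
  ∙-neg []            S n = sym -0#≈0#
  ∙-neg ((e , a) ∷ p) S n = trans (+-cong (sym (-‿distribʳ-* _ _)) (∙-neg p S n)) (-‿+-comm _ _)

  ∙-sub : ∀ p S T n → (p ∙ (λ m → S m - T m)) n ≈ (p ∙ S) n - (p ∙ T) n
  ∙-sub p S T n = trans (∙-+ p S (λ m → - T m) n) (+-congˡ (∙-neg p T n))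

  ∙-scale : ∀ p b S n → (p ∙ (λ m → b * S m)) n ≈ b * (p ∙ S) n
  ∙-scale []            b S n = sym (zeroʳ _)
  ∙-scale ((e , a) ∷ p) b S n = begin
    a * (b * S (n ℤ.- e)) + (p ∙ (λ m → b * S m)) n
      ≈⟨ +-cong (x∙yz≈y∙xz a b _) (∙-scale p b S n) ⟩
    b * (a * S (n ℤ.- e)) + b * (p ∙ S) n
      ≈⟨ sym (distribˡ _ _ _) ⟩
    b * (a * S (n ℤ.- e) + (p ∙ S) n) ∎
    where open import Algebra.Properties.CommutativeSemigroup *-commutativeSemigroup using (x∙yz≈y∙xz)

  ∙-zero : ∀ p n → (p ∙ (λ _ → 0#)) n ≈ 0#
  ∙-zero []            n = refl
  ∙-zero ((e , a) ∷ p) n = trans (+-cong (zeroʳ _) (∙-zero p n)) (+-identityˡ _)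

  shift : ℤ → Series → Series
  shift e S m = S (m ℤ.- e)

  ∙-shift : ∀ q S e n → (q ∙ S) (n ℤ.- e) ≈ (q ∙ shift e S) n
  ∙-shift []            S e n = refl
  ∙-shift ((u , b) ∷ q) S e n =
    +-cong (*-congˡ (reflexive (≡.cong S (swap n e u)))) (∙-shift q S e n)
    where
    swap : ∀ n e u → n ℤ.- e ℤ.- u ≡ n ℤ.- u ℤ.- e
    swap = solve-∀

  mono-∙ : ∀ e a S n → (mono e a ∙ S) n ≈ a * S (n ℤ.- e)
  mono-∙ e a S n = +-identityʳ _

  X-∙ : ∀ e S n → (X e ∙ S) n ≈ S (n ℤ.- e)
  X-∙ e S n = trans (mono-∙ e 1# S n) (*-identityˡ _)

  ⊗-∙ : ∀ p q S n → ((p ⊗ q) ∙ S) n ≈ (p ∙ (q ∙ S)) n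
  ⊗-∙ []            q S n = refl
  ⊗-∙ ((e , a) ∷ p) q S n = begin
    ((eaq ++ (p ⊗ q)) ∙ S) n              ≈⟨ ⊕-∙ eaq (p ⊗ q) S n ⟩
    (eaq ∙ S) n + ((p ⊗ q) ∙ S) n         ≈⟨ +-cong (term q) (⊗-∙ p q S n) ⟩
    a * (q ∙ S) (n ℤ.- e) + (p ∙ (q ∙ S)) n ∎
    where
    eaq = map (λ u → e ℤ.+ proj₁ u , a * proj₂ u) q
    assoc : ∀ n e u → n ℤ.- (e ℤ.+ u) ≡ n ℤ.- e ℤ.- u
    assoc = solve-∀
    term : ∀ q → (map (λ u → e ℤ.+ proj₁ u , a * proj₂ u) q ∙ S) n ≈ a * (q ∙ S) (n ℤ.- e)
    term []            = sym (zeroʳ _)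
    term ((u , b) ∷ q) = begin
      (a * b) * S (n ℤ.- (e ℤ.+ u)) + _   ≈⟨ +-cong (*-congˡ (reflexive (≡.cong S (assoc n e u)))) (term q) ⟩
      (a * b) * S (n ℤ.- e ℤ.- u) + a * (q ∙ S) (n ℤ.- e) ≈⟨ +-congʳ (*-assoc _ _ _) ⟩
      a * (b * S (n ℤ.- e ℤ.- u)) + a * (q ∙ S) (n ℤ.- e) ≈⟨ sym (distribˡ _ _ _) ⟩
      a * (((u , b) ∷ q) ∙ S) (n ℤ.- e)    ∎

  ∙-comm : ∀ p q S n → (p ∙ (q ∙ S)) n ≈ (q ∙ (p ∙ S)) n
  ∙-comm []            q S n = sym (∙-zero q n)
  ∙-comm ((e , a) ∷ p) q S n = begin
    a * (q ∙ S) (n ℤ.- e) + (p ∙ (q ∙ S)) n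
      ≈⟨ +-cong (*-congˡ (∙-shift q S e n)) (∙-comm p q S n) ⟩
    a * (q ∙ shift e S) n + (q ∙ (p ∙ S)) n
      ≈⟨ +-congʳ (sym (∙-scale q a (shift e S) n)) ⟩
    (q ∙ (λ m → a * shift e S m)) n + (q ∙ (p ∙ S)) n
      ≈⟨ sym (∙-+ q (λ m → a * shift e S m) (p ∙ S) n) ⟩
    (q ∙ (((e , a) ∷ p) ∙ S)) n ∎

  -- The ring of Laurent polynomials

  -- The list representation is not canonical: polynomials are identified
  -- when they multiply every series alike.
  infix 4 _∼_
  record _∼_ (p q : LPoly) : Set (c Level.⊔ ℓ) where
    constructor mk∼
    field ∙-∼ : ∀ S → p ∙ S ≈ₛ q ∙ S
  open _∼_ public

  𝟘 𝟙 : LPoly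
  𝟘 = []
  𝟙 = X (+ 0)

  𝟙-∙ : ∀ S n → (𝟙 ∙ S) n ≈ S n
  𝟙-∙ S n = trans (X-∙ (+ 0) S n) (reflexive (≡.cong S (ℤ.+-identityʳ n)))

  ∼-isEquivalence : IsEquivalence _∼_
  ∼-isEquivalence = record
    { refl  = mk∼ λ S n → refl
    ; sym   = λ p∼q → mk∼ λ S n → sym (∙-∼ p∼q S n)
    ; trans = λ p∼q q∼r → mk∼ λ S n → trans (∙-∼ p∼q S n) (∙-∼ q∼r S n)
    }

  private
    by-⊕ : ∀ p q p′ q′ → (∀ S n → (p ∙ S) n + (q ∙ S) n ≈ (p′ ∙ S) n + (q′ ∙ S) n) → p ⊕ q ∼ p′ ⊕ q′
    by-⊕ p q p′ q′ eq = mk∼ λ S n → trans (⊕-∙ p q S n) (trans (eq S n) (sym (⊕-∙ p′ q′ S n)))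

    by-⊗ : ∀ p q p′ q′ → (∀ S n → (p ∙ (q ∙ S)) n ≈ (p′ ∙ (q′ ∙ S)) n) → p ⊗ q ∼ p′ ⊗ q′
    by-⊗ p q p′ q′ eq = mk∼ λ S n → trans (⊗-∙ p q S n) (trans (eq S n) (sym (⊗-∙ p′ q′ S n)))

  ⊕-cong : ∀ {p p′ q q′} → p ∼ p′ → q ∼ q′ → p ⊕ q ∼ p′ ⊕ q′
  ⊕-cong {p} {p′} {q} {q′} p∼p′ q∼q′ = by-⊕ p q p′ q′ λ S n → +-cong (∙-∼ p∼p′ S n) (∙-∼ q∼q′ S n)

  ⊕-assoc : ∀ p q r → (p ⊕ q) ⊕ r ∼ p ⊕ (q ⊕ r)
  ⊕-assoc p q r = by-⊕ (p ⊕ q) r p (q ⊕ r) λ S n →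
    trans (+-congʳ (⊕-∙ p q S n)) (trans (+-assoc _ _ _) (+-congˡ (sym (⊕-∙ q r S n))))

  ⊕-comm : ∀ p q → p ⊕ q ∼ q ⊕ p
  ⊕-comm p q = by-⊕ p q q p λ S n → +-comm _ _

  ⊕-identityʳ : ∀ p → p ⊕ 𝟘 ∼ p
  ⊕-identityʳ p = mk∼ λ S n → trans (⊕-∙ p [] S n) (+-identityʳ _)

  ⊝-cong : ∀ {p q} → p ∼ q → ⊝ p ∼ ⊝ q
  ⊝-cong {p} {q} p∼q = mk∼ λ S n → trans (⊝-∙ p S n) (trans (-‿cong (∙-∼ p∼q S n)) (sym (⊝-∙ q S n)))

  ⊝-inverseʳ : ∀ p → p ⊖ p ∼ 𝟘
  ⊝-inverseʳ p = mk∼ λ S n → trans (⊖-∙ p p S n) (-‿inverseʳ _)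

  ⊝-inverseˡ : ∀ p → ⊝ p ⊕ p ∼ 𝟘
  ⊝-inverseˡ p = mk∼ λ S n → trans (⊕-∙ (⊝ p) p S n) (trans (+-congʳ (⊝-∙ p S n)) (-‿inverseˡ _))

  ⊗-cong : ∀ {p p′ q q′} → p ∼ p′ → q ∼ q′ → p ⊗ q ∼ p′ ⊗ q′
  ⊗-cong {p} {p′} {q} {q′} p∼p′ q∼q′ = by-⊗ p q p′ q′ λ S n → trans (∙-congʳ p (∙-∼ q∼q′ S) n) (∙-∼ p∼p′ (q′ ∙ S) n)

  ⊗-assoc : ∀ p q r → (p ⊗ q) ⊗ r ∼ p ⊗ (q ⊗ r)
  ⊗-assoc p q r = by-⊗ (p ⊗ q) r p (q ⊗ r) λ S n → trans (⊗-∙ p q (r ∙ S) n) (∙-congʳ p (λ m → sym (⊗-∙ q r S m)) n)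

  ⊗-comm : ∀ p q → p ⊗ q ∼ q ⊗ p
  ⊗-comm p q = by-⊗ p q q p λ S n → ∙-comm p q S n

  ⊗-identityˡ : ∀ p → 𝟙 ⊗ p ∼ p
  ⊗-identityˡ p = mk∼ λ S n → trans (⊗-∙ 𝟙 p S n) (𝟙-∙ (p ∙ S) n)

  ⊗-identityʳ : ∀ p → p ⊗ 𝟙 ∼ p
  ⊗-identityʳ p = mk∼ λ S n → trans (⊗-∙ p 𝟙 S n) (∙-congʳ p (𝟙-∙ S) n)

  ⊗-distribˡ : ∀ p q r → p ⊗ (q ⊕ r) ∼ p ⊗ q ⊕ p ⊗ r
  ⊗-distribˡ p q r = mk∼ λ S n → trans (⊗-∙ p (q ⊕ r) S n) (trans (∙-congʳ p (⊕-∙ q r S) n)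
    (trans (∙-+ p (q ∙ S) (r ∙ S) n)
    (sym (trans (⊕-∙ (p ⊗ q) (p ⊗ r) S n) (+-cong (⊗-∙ p q S n) (⊗-∙ p r S n))))))

  ⊗-distribʳ : ∀ p q r → (q ⊕ r) ⊗ p ∼ q ⊗ p ⊕ r ⊗ p
  ⊗-distribʳ p q r = mk∼ λ S n → trans (⊗-∙ (q ⊕ r) p S n) (trans (⊕-∙ q r (p ∙ S) n)
    (sym (trans (⊕-∙ (q ⊗ p) (r ⊗ p) S n) (+-cong (⊗-∙ q p S n) (⊗-∙ r p S n)))))

  ∼-isCommutativeRing : IsCommutativeRing _∼_ _⊕_ _⊗_ ⊝_ 𝟘 𝟙
  ∼-isCommutativeRing = record
    { isRing = record
      { +-isAbelianGroup = record
        { isGroup = record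
          { isMonoid = record
            { isSemigroup = record
              { isMagma = record { isEquivalence = ∼-isEquivalence ; ∙-cong = ⊕-cong }
              ; assoc   = ⊕-assoc
              }
            ; identity = (λ p → IsEquivalence.refl ∼-isEquivalence) , ⊕-identityʳ
            }
          ; inverse = ⊝-inverseˡ , ⊝-inverseʳ
          ; ⁻¹-cong = ⊝-cong
          }
        ; comm = ⊕-comm
        }
      ; *-cong     = ⊗-cong
      ; *-assoc    = ⊗-assoc
      ; *-identity = ⊗-identityˡ , ⊗-identityʳ
      ; distrib    = ⊗-distribˡ , ⊗-distribʳ
      }
    ; *-comm = ⊗-comm
    }

  laurentRing : CommutativeRing c (c Level.⊔ ℓ)
  laurentRing = record { isCommutativeRing = ∼-isCommutativeRing }

  module 𝓛 = CommutativeRing laurentRing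
  module 𝓛S = IntegerCoefficientSolver laurentRing

  ⊗-congˡ : ∀ p {q q′} → q ∼ q′ → p ⊗ q ∼ p ⊗ q′
  ⊗-congˡ p = 𝓛.*-cong (𝓛.refl {p})

  ⊗-congʳ : ∀ q {p p′} → p ∼ p′ → p ⊗ q ∼ p′ ⊗ q
  ⊗-congʳ q p∼p′ = 𝓛.*-cong p∼p′ (𝓛.refl {q})

  ⊖-congˡ : ∀ p {q q′} → q ∼ q′ → p ⊖ q ∼ p ⊖ q′
  ⊖-congˡ p q∼q′ = 𝓛.+-cong (𝓛.refl {p}) (𝓛.-‿cong q∼q′)

  ⊖-congʳ : ∀ q {p p′} → p ∼ p′ → p ⊖ q ∼ p′ ⊖ q
  ⊖-congʳ q p∼p′ = 𝓛.+-cong p∼p′ (𝓛.refl {⊝ q})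

  p⊕q⊖q∼p : ∀ p q → p ⊕ q ⊖ q ∼ p
  p⊕q⊖q∼p = 𝓛S.solve 2 (λ p q → p :+ q :- q := p) 𝓛.refl
    where open 𝓛S

  ⊖-cong : ∀ {p p′ q q′} → p ∼ p′ → q ∼ q′ → p ⊖ q ∼ p′ ⊖ q′
  ⊖-cong p∼p′ q∼q′ = 𝓛.+-cong p∼p′ (𝓛.-‿cong q∼q′)

  δ : Series
  δ m with m ℤ.≟ + 0
  ... | yes _ = 1#
  ... | no _  = 0#

  δ-≢0 : ∀ {m} → m ≢ + 0 → δ m ≈ 0#
  δ-≢0 {m} m≢0 with m ℤ.≟ + 0
  ... | yes m≡0 = ⊥-elim (m≢0 m≡0)
  ... | no _    = refl

  δ-neg : ∀ m → δ (ℤ.- m) ≈ δ m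
  δ-neg m with m ℤ.≟ + 0
  ... | yes ≡.refl = refl
  ... | no m≢0     = δ-≢0 (λ -m≡0 → m≢0 (ℤ.neg-injective -m≡0))

  δ-i-i : ∀ i → δ (i ℤ.- i) ≈ 1#
  δ-i-i i = reflexive (≡.cong δ (ℤ.+-inverseʳ i))

  δ-i-j : ∀ {i j} → i ≢ j → δ (i ℤ.- j) ≈ 0#
  δ-i-j {i} {j} i≢j = δ-≢0 (λ i-j≡0 → i≢j (ℤ.i-j≡0⇒i≡j i j i-j≡0))

  coeffP≈∙δ : ∀ p n → coeffP p n ≈ (p ∙ δ) n
  coeffP≈∙δ []            n = refl
  coeffP≈∙δ ((e , a) ∷ p) n with e ℤ.≟ n
  ... | yes ≡.refl = +-cong (sym (trans (*-congˡ (δ-i-i e)) (*-identityʳ a))) (coeffP≈∙δ p n)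
  ... | no e≢n     = +-cong (sym (trans (*-congˡ (δ-i-j (e≢n ∘ ≡.sym))) (zeroʳ a))) (coeffP≈∙δ p n)

  coeffP-cong : ∀ {p q} → p ∼ q → ∀ n → coeffP p n ≈ coeffP q n
  coeffP-cong {p} {q} p∼q n = trans (coeffP≈∙δ p n) (trans (∙-∼ p∼q δ n) (sym (coeffP≈∙δ q n)))

  coeffP-⊗ : ∀ p q n → coeffP (p ⊗ q) n ≈ (p ∙ coeffP q) n
  coeffP-⊗ p q n = trans (coeffP≈∙δ (p ⊗ q) n)
    (trans (⊗-∙ p q δ n) (∙-congʳ p (λ m → sym (coeffP≈∙δ q m)) n))

  coeffP-⊖ : ∀ p q n → coeffP (p ⊖ q) n ≈ coeffP p n - coeffP q n
  coeffP-⊖ p q n = trans (coeffP≈∙δ (p ⊖ q) n)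
    (trans (⊖-∙ p q δ n) (sym (+-cong (coeffP≈∙δ p n) (-‿cong (coeffP≈∙δ q n)))))

  ∙-expansion-⊗ : ∀ Q P S N → P ∙ S ≈ₛ coeffP N → (Q ⊗ P) ∙ S ≈ₛ coeffP (Q ⊗ N)
  ∙-expansion-⊗ Q P S N PS≈N n =
    trans (⊗-∙ Q P S n) (trans (∙-congʳ Q PS≈N n) (sym (coeffP-⊗ Q N n)))

  const : K → LPoly
  const = mono (+ 0)

  const-∙ : ∀ a S n → (const a ∙ S) n ≈ a * S n
  const-∙ a S n = trans (mono-∙ (+ 0) a S n) (*-congˡ (reflexive (≡.cong S (ℤ.+-identityʳ n))))

  const-cong : ∀ {a b} → a ≈ b → const a ∼ const b
  const-cong a≈b = mk∼ λ S n → trans (const-∙ _ S n) (trans (*-congʳ a≈b) (sym (const-∙ _ S n)))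

  const-+ : ∀ a b → const (a + b) ∼ const a ⊕ const b
  const-+ a b = mk∼ λ S n → trans (const-∙ (a + b) S n) (trans (distribʳ _ _ _)
    (sym (trans (⊕-∙ (const a) (const b) S n) (+-cong (const-∙ a S n) (const-∙ b S n)))))

  mono≈const⊗X : ∀ e a → mono e a ∼ const a ⊗ X e
  mono≈const⊗X e a = mk∼ λ S n → trans (mono-∙ e a S n) (sym (trans (⊗-∙ (const a) (X e) S n)
    (trans (const-∙ a (X e ∙ S) n) (*-congˡ (X-∙ e S n)))))

  X-+ : ∀ a b → X (a ℤ.+ b) ∼ X a ⊗ X b
  X-+ a b = mk∼ λ S n → trans (X-∙ (a ℤ.+ b) S n) (sym (trans (⊗-∙ (X a) (X b) S n)
    (trans (X-∙ a (X b ∙ S) n) (trans (X-∙ b S (n ℤ.- a)) (reflexive (≡.cong S (assoc n a b)))))))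
    where
    assoc : ∀ n a b → n ℤ.- a ℤ.- b ≡ n ℤ.- (a ℤ.+ b)
    assoc = solve-∀

  infix 4 _≤ord_
  _≤ord_ : ℤ → LPoly → Set c
  b ≤ord p = All (λ t → b ≤ proj₁ t) p

  VanishesBelow : ℤ → Series → Set ℓ
  VanishesBelow n S = ∀ m → m < n → S m ≈ 0#

  ≤ord-⊕ : ∀ {b p q} → b ≤ord p → b ≤ord q → b ≤ord (p ⊕ q)
  ≤ord-⊕ = All.++⁺

  ≤ord-⊝ : ∀ {b p} → b ≤ord p → b ≤ord (⊝ p)
  ≤ord-⊝ []         = []
  ≤ord-⊝ (b≤e ∷ bp) = b≤e ∷ ≤ord-⊝ bp

  ≤ord-⊖ : ∀ {b p q} → b ≤ord p → b ≤ord q → b ≤ord (p ⊖ q)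
  ≤ord-⊖ bp bq = ≤ord-⊕ bp (≤ord-⊝ bq)

  ≤ord-weaken : ∀ {b b′ p} → b′ ≤ b → b ≤ord p → b′ ≤ord p
  ≤ord-weaken b′≤b = All.map (ℤ.≤-trans b′≤b)

  ≤ord-⊗ : ∀ {a b p q} → a ≤ord p → b ≤ord q → (a ℤ.+ b) ≤ord (p ⊗ q)
  ≤ord-⊗ []                            bq = []
  ≤ord-⊗ {p = (e , x) ∷ p} (a≤e ∷ ap) bq = ≤ord-⊕ (shifted bq) (≤ord-⊗ ap bq)
    where
    shifted : ∀ {b q} → b ≤ord q → _ ≤ord map (λ u → e ℤ.+ proj₁ u , x * proj₂ u) q
    shifted []         = []
    shifted (b≤u ∷ bq) = ℤ.+-mono-≤ a≤e b≤u ∷ shifted bq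

  private
    m-e≤m-b : ∀ {b e} m → b ≤ e → m ℤ.- e ≤ m ℤ.- b
    m-e≤m-b m b≤e = ℤ.+-monoʳ-≤ m (ℤ.neg-mono-≤ b≤e)

    m+b-b≡m : ∀ m b → m ℤ.+ b ℤ.- b ≡ m
    m+b-b≡m = solve-∀

    <-+⇒-< : ∀ {m h b} → m < h ℤ.+ b → m ℤ.- b < h
    <-+⇒-< {m} {h} {b} m<h+b = ℤ.<-≤-trans (ℤ.+-monoˡ-< (ℤ.- b) m<h+b) (ℤ.≤-reflexive (m+b-b≡m h b))

    m+p-e<m : ∀ {p e} m → p < e → m ℤ.+ p ℤ.- e < m
    m+p-e<m {p} m p<e = ℤ.<-≤-trans (ℤ.+-monoʳ-< (m ℤ.+ p) (ℤ.neg-mono-< p<e)) (ℤ.≤-reflexive (m+b-b≡m m p))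

  ∙-vanishesBelow : ∀ {b h S} p → b ≤ord p → VanishesBelow h S → VanishesBelow (h ℤ.+ b) (p ∙ S)
  ∙-vanishesBelow []            []         S₀ m m<h+b = refl
  ∙-vanishesBelow {S = S} ((e , a) ∷ p) (b≤e ∷ bp) S₀ m m<h+b = begin
    a * S (m ℤ.- e) + (p ∙ S) m   ≈⟨ +-cong (*-congˡ (S₀ _ (ℤ.≤-<-trans (m-e≤m-b m b≤e) (<-+⇒-< m<h+b))))
                                            (∙-vanishesBelow p bp S₀ m m<h+b) ⟩
    a * 0# + 0#                   ≈⟨ trans (+-identityʳ _) (zeroʳ a) ⟩
    0#                            ∎

  vanishesBelow-sub : ∀ {m n S T} → VanishesBelow m S → VanishesBelow n T →
                      VanishesBelow (m ℤ.⊓ n) (λ k → S k - T k)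
  vanishesBelow-sub {m} {n} S₀ T₀ k k<m⊓n =
    trans (+-cong (S₀ k (ℤ.<-≤-trans k<m⊓n (ℤ.i⊓j≤i m n))) (-‿cong (T₀ k (ℤ.<-≤-trans k<m⊓n (ℤ.i⊓j≤j m n)))))
          (-‿inverseʳ 0#)

  δ-vanishesBelow : VanishesBelow (+ 0) δ
  δ-vanishesBelow m m<0 = δ-≢0 (λ m≡0 → ℤ.<-irrefl m≡0 m<0)

  coeffP-vanishesBelow : ∀ {b} p → b ≤ord p → VanishesBelow b (coeffP p)
  coeffP-vanishesBelow {b} p bp m m<b = trans (coeffP≈∙δ p m)
    (∙-vanishesBelow p bp δ-vanishesBelow m (ℤ.<-≤-trans m<b (ℤ.≤-reflexive (≡.sym (ℤ.+-identityˡ b)))))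

  ∙-local : ∀ {b S T} p → b ≤ord p → ∀ n → (∀ m → m ≤ n ℤ.- b → S m ≈ T m) → (p ∙ S) n ≈ (p ∙ T) n
  ∙-local []            []         n S≈T = refl
  ∙-local ((e , a) ∷ p) (b≤e ∷ bp) n S≈T =
    +-cong (*-congˡ (S≈T _ (m-e≤m-b n b≤e))) (∙-local p bp n S≈T)

  ∙-lowest : ∀ {p₀ n S} P → p₀ ≤ord P → VanishesBelow n S →
             (P ∙ S) (n ℤ.+ p₀) ≈ coeffP P p₀ * S n
  ∙-lowest {p₀} {n} {S} P p₀P S₀ = trans (go P p₀P) (*-congʳ (sym (coeffP≈∙δ P p₀)))
    where
    term : ∀ e a → p₀ ≤ e → a * S (n ℤ.+ p₀ ℤ.- e) ≈ a * δ (p₀ ℤ.- e) * S n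
    term e a p₀≤e with e ℤ.≟ p₀
    ... | yes ≡.refl = begin
      a * S (n ℤ.+ e ℤ.- e)     ≡⟨ ≡.cong (λ m → a * S m) (m+b-b≡m n e) ⟩
      a * S n                   ≈⟨ *-congʳ (sym (trans (*-congˡ (δ-i-i e)) (*-identityʳ a))) ⟩
      a * δ (e ℤ.- e) * S n     ∎
    ... | no e≢p₀ = begin
      a * S (n ℤ.+ p₀ ℤ.- e)    ≈⟨ *-congˡ (S₀ _ (m+p-e<m n (ℤ.≤∧≢⇒< p₀≤e (e≢p₀ ∘ ≡.sym)))) ⟩
      a * 0#                    ≈⟨ zeroʳ a ⟩
      0#                        ≈⟨ sym (zeroˡ _) ⟩
      0# * S n                  ≈⟨ *-congʳ (sym (trans (*-congˡ (δ-i-j (e≢p₀ ∘ ≡.sym))) (zeroʳ a))) ⟩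
      a * δ (p₀ ℤ.- e) * S n    ∎
    go : ∀ P → p₀ ≤ord P → (P ∙ S) (n ℤ.+ p₀) ≈ (P ∙ δ) p₀ * S n
    go []            []           = sym (zeroˡ _)
    go ((e , a) ∷ P) (p₀≤e ∷ p₀P) = trans (+-cong (term e a p₀≤e) (go P p₀P)) (sym (distribʳ _ _ _))

  coeffP-⊗-lowest : ∀ {α β} p q → α ≤ord p → β ≤ord q →
                    coeffP (p ⊗ q) (α ℤ.+ β) ≈ coeffP p α * coeffP q β
  coeffP-⊗-lowest {α} {β} p q αp βq = begin
    coeffP (p ⊗ q) (α ℤ.+ β)   ≡⟨ ≡.cong (coeffP (p ⊗ q)) (ℤ.+-comm α β) ⟩
    coeffP (p ⊗ q) (β ℤ.+ α)   ≈⟨ coeffP-⊗ p q (β ℤ.+ α) ⟩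
    (p ∙ coeffP q) (β ℤ.+ α)   ≈⟨ ∙-lowest p αp (coeffP-vanishesBelow q βq) ⟩
    coeffP p α * coeffP q β    ∎

  -- Division by a Laurent polynomial whose lowest coefficient is a unit

  private
    below-or-from : ∀ n₀ n → n < n₀ ⊎ ∃ λ k → n ≡ n₀ ℤ.+ + k
    below-or-from n₀ n with n ℤ.<? n₀
    ... | yes n<n₀ = inj₁ n<n₀
    ... | no  n≮n₀ = inj₂ (ℤ.∣ n ℤ.- n₀ ∣ ,
          ≡.trans (split n n₀) (≡.cong (λ i → n₀ ℤ.+ i) (≡.sym (ℤ.0≤i⇒+∣i∣≡i 0≤n-n₀))))
      where
      split : ∀ n n₀ → n ≡ n₀ ℤ.+ (n ℤ.- n₀)
      split = solve-∀
      0≤n-n₀ : + 0 ≤ n ℤ.- n₀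
      0≤n-n₀ = ℤ.≤-trans (ℤ.≤-reflexive (≡.sym (ℤ.+-inverseʳ n₀))) (ℤ.+-monoˡ-≤ (ℤ.- n₀) (ℤ.≮⇒≥ n≮n₀))

    n+k<n+1+k : ∀ n k → n ℤ.+ + k < n ℤ.+ + suc k
    n+k<n+1+k n k = ℤ.+-monoʳ-< n (ℤ.+<+ (ℕ.n<1+n k))

    m<n+1+k⇒m≤n+k : ∀ m n k → m < n ℤ.+ + suc k → m ≤ n ℤ.+ + k
    m<n+1+k⇒m≤n+k m n k m<n+1+k = ℤ.≤-trans (ℤ.i<j⇒i≤pred[j] m<n+1+k) (ℤ.≤-reflexive (pred-+suc n k))
      where
      pred-+suc : ∀ n k → ℤ.pred (n ℤ.+ + suc k) ≡ n ℤ.+ + k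
      pred-+suc n k = ≡.trans (≡.cong (λ i → ℤ.pred (n ℤ.+ i)) (ℤ.pos-+ 1 k)) (shuffle n (+ k))
        where
        shuffle : ∀ n k → ℤ.-1ℤ ℤ.+ (n ℤ.+ (+ 1 ℤ.+ k)) ≡ n ℤ.+ k
        shuffle = solve-∀

    n≤n+k : ∀ n k → n ≤ n ℤ.+ + k
    n≤n+k n k = ℤ.≤-trans (ℤ.≤-reflexive (≡.sym (ℤ.+-identityʳ n))) (ℤ.+-monoʳ-≤ n (ℤ.+≤+ ℕ.z≤n))

    unit-cancel : ∀ {a u x} → a * u ≈ 1# → a * x ≈ 0# → x ≈ 0#
    unit-cancel {a} {u} {x} au≈1 ax≈0 = begin
      x               ≈⟨ sym (*-identityˡ x) ⟩
      1# * x          ≈⟨ *-congʳ (sym au≈1) ⟩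
      (a * u) * x     ≈⟨ KS.solve 3 (λ a u x → (a :* u) :* x := u :* (a :* x)) refl a u x ⟩
      u * (a * x)     ≈⟨ *-congˡ ax≈0 ⟩
      u * 0#          ≈⟨ zeroʳ u ⟩
      0#              ∎
      where open KS

  -- Upwards from n₀: at the lowest exponent where E might not vanish, P ∙ E
  -- has coefficient coeffP P p₀ times that of E.
  ∙-vanishesBelow⁻¹ : ∀ {p₀ u n₀ q} P → p₀ ≤ord P → coeffP P p₀ * u ≈ 1# →
                      ∀ E → VanishesBelow n₀ E → VanishesBelow q (P ∙ E) →
                      VanishesBelow (q ℤ.- p₀) E
  ∙-vanishesBelow⁻¹ {p₀} {u} {n₀} {q} P p₀P unit E E₀ PE₀ m m<q-p₀
    with below-or-from n₀ m
  ... | inj₁ m<n₀         = E₀ m m<n₀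
  ... | inj₂ (k , ≡.refl) = upTo (suc k) _ (n+k<n+1+k n₀ k) m<q-p₀
    where
    upTo : ∀ k m → m < n₀ ℤ.+ + k → m < q ℤ.- p₀ → E m ≈ 0#
    upTo zero    m m<n₀ _ = E₀ m (ℤ.<-≤-trans m<n₀ (ℤ.≤-reflexive (ℤ.+-identityʳ n₀)))
    upTo (suc k) m m<n₀+1+k m<q-p₀ with m ℤ.≟ n₀ ℤ.+ + k
    ... | no  m≢n₀+k  = upTo k m (ℤ.≤∧≢⇒< (m<n+1+k⇒m≤n+k m n₀ k m<n₀+1+k) m≢n₀+k) m<q-p₀
    ... | yes ≡.refl = unit-cancel unit (trans (sym (∙-lowest P p₀P below)) (PE₀ _ m+p₀<q))
      where
      below : VanishesBelow (n₀ ℤ.+ + k) E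
      below m′ m′<m = upTo k m′ m′<m (ℤ.<-trans m′<m m<q-p₀)
      m+p₀<q : n₀ ℤ.+ + k ℤ.+ p₀ < q
      m+p₀<q = ℤ.<-≤-trans (ℤ.+-monoˡ-< p₀ m<q-p₀) (ℤ.≤-reflexive (cancel q p₀))
        where
        cancel : ∀ q p → q ℤ.- p ℤ.+ p ≡ q
        cancel = solve-∀

  -- approx k fixes the coefficients of Q / P at n₀, …, n₀ + k - 1, each one
  -- chosen so that P ∙ approx agrees with Q one exponent further up.
  module Quotient {p₀ u q₀} (P : LPoly) (p₀P : p₀ ≤ord P) (unit : coeffP P p₀ * u ≈ 1#)
                  (Q : LPoly) (q₀Q : q₀ ≤ord Q) where

    n₀ : ℤ
    n₀ = q₀ ℤ.- p₀

    private
      at : ℕ → ℤ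
      at k = n₀ ℤ.+ + k

      approx : ℕ → Series
      next   : ℕ → K
      approx zero    n = 0#
      approx (suc k) n with n ℤ.≟ at k
      ... | yes _ = next k
      ... | no _  = approx k n
      next k = u * (coeffP Q (at k ℤ.+ p₀) - (P ∙ approx k) (at k ℤ.+ p₀))

      approx-vanishes : ∀ k n → n < n₀ ⊎ at k ≤ n → approx k n ≈ 0#
      approx-vanishes zero    n _ = refl
      approx-vanishes (suc k) n out with n ℤ.≟ at k | out
      ... | yes ≡.refl | inj₁ n<n₀  = ⊥-elim (ℤ.<-irrefl ≡.refl (ℤ.<-≤-trans n<n₀ (n≤n+k n₀ k)))
      ... | yes ≡.refl | inj₂ n+k<n = ⊥-elim (ℤ.<-irrefl ≡.refl (ℤ.<-≤-trans (n+k<n+1+k n₀ k) n+k<n))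
      ... | no _       | inj₁ n<n₀  = approx-vanishes k n (inj₁ n<n₀)
      ... | no _       | inj₂ k<n   = approx-vanishes k n (inj₂ (ℤ.≤-trans (ℤ.<⇒≤ (n+k<n+1+k n₀ k)) k<n))

      approx-step : ∀ k n → n < at k → approx (suc k) n ≈ approx k n
      approx-step k n n<k with n ℤ.≟ at k
      ... | yes ≡.refl = ⊥-elim (ℤ.<-irrefl ≡.refl n<k)
      ... | no _       = refl

      approx-stable : ∀ d k n → n < at k → approx (d ℕ.+ k) n ≈ approx k n
      approx-stable zero    k n n<k = refl
      approx-stable (suc d) k n n<k = trans
        (approx-step (d ℕ.+ k) n (ℤ.<-≤-trans n<k (ℤ.+-monoʳ-≤ n₀ (ℤ.+≤+ (ℕ.m≤n+m k d)))))
        (approx-stable d k n n<k)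

      approx-suc : ∀ k n → approx (suc k) n ≈ approx k n + next k * δ (n ℤ.- at k)
      approx-suc k n with n ℤ.≟ at k
      ... | yes ≡.refl = begin
        next k                                   ≈⟨ sym (*-identityʳ _) ⟩
        next k * 1#                              ≈⟨ *-congˡ (sym (δ-i-i (at k))) ⟩
        next k * δ (at k ℤ.- at k)               ≈⟨ sym (+-identityˡ _) ⟩
        0# + next k * δ (at k ℤ.- at k)          ≈⟨ +-congʳ (sym (approx-vanishes k (at k) (inj₂ ℤ.≤-refl))) ⟩
        approx k (at k) + next k * δ (at k ℤ.- at k) ∎
      ... | no n≢k = sym (trans (+-congˡ (trans (*-congˡ (δ-i-j n≢k)) (zeroʳ _))) (+-identityʳ _))

      approx-solves : ∀ k → (P ∙ approx (suc k)) (at k ℤ.+ p₀) ≈ coeffP Q (at k ℤ.+ p₀)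
      approx-solves k = begin
        (P ∙ approx (suc k)) m
          ≈⟨ ∙-congʳ P (approx-suc k) m ⟩
        (P ∙ (λ n → approx k n + next k * shift (at k) δ n)) m
          ≈⟨ ∙-+ P (approx k) (λ n → next k * shift (at k) δ n) m ⟩
        Pa + (P ∙ (λ n → next k * shift (at k) δ n)) m
          ≈⟨ +-congˡ (∙-scale P (next k) (shift (at k) δ) m) ⟩
        Pa + next k * (P ∙ shift (at k) δ) m
          ≈⟨ +-congˡ (*-congˡ (sym (∙-shift P δ (at k) m))) ⟩
        Pa + next k * (P ∙ δ) (m ℤ.- at k)
          ≡⟨ ≡.cong (λ i → Pa + next k * (P ∙ δ) i) (cancel (at k) p₀) ⟩
        Pa + next k * (P ∙ δ) p₀
          ≈⟨ +-congˡ (*-congˡ (sym (coeffP≈∙δ P p₀))) ⟩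
        Pa + (u * (Qm - Pa)) * coeffP P p₀
          ≈⟨ KS.solve 4 (λ a b u c → a :+ (u :* (b :- a)) :* c := a :+ (b :- a) :* (c :* u)) refl Pa Qm u (coeffP P p₀) ⟩
        Pa + (Qm - Pa) * (coeffP P p₀ * u)
          ≈⟨ +-congˡ (trans (*-congˡ unit) (*-identityʳ _)) ⟩
        Pa + (Qm - Pa)
          ≈⟨ solve 2 (λ a b → a :+ (b :- a) := b) refl Pa Qm ⟩
        Qm ∎
        where
        open KS
        m = at k ℤ.+ p₀
        Pa = (P ∙ approx k) m
        Qm = coeffP Q m
        cancel : ∀ a p → a ℤ.+ p ℤ.- a ≡ p
        cancel = solve-∀

    opaque
      quotient : Series
      quotient n = approx (suc ℤ.∣ n ℤ.- n₀ ∣) n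

      quotient-vanishesBelow : VanishesBelow n₀ quotient
      quotient-vanishesBelow n n<n₀ = approx-vanishes (suc ℤ.∣ n ℤ.- n₀ ∣) n (inj₁ n<n₀)

      private
        quotient≈approx : ∀ k n → n ≤ at k → quotient n ≈ approx (suc k) n
        quotient≈approx k n n≤k with below-or-from n₀ n
        ... | inj₁ n<n₀         = trans (quotient-vanishesBelow n n<n₀)
                                        (sym (approx-vanishes (suc k) n (inj₁ n<n₀)))
        ... | inj₂ (j , ≡.refl) = begin
          approx (suc ℤ.∣ at j ℤ.- n₀ ∣) (at j)  ≡⟨ ≡.cong (λ i → approx (suc i) (at j)) (∣at-n₀∣ j) ⟩
          approx (suc j) (at j)                  ≈⟨ sym (approx-stable (k ℕ.∸ j) (suc j) (at j) (n+k<n+1+k n₀ j)) ⟩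
          approx (k ℕ.∸ j ℕ.+ suc j) (at j)      ≡⟨ ≡.cong (λ i → approx i (at j)) k∸j+1+j≡1+k ⟩
          approx (suc k) (at j)                  ∎
          where
          ∣at-n₀∣ : ∀ j → ℤ.∣ at j ℤ.- n₀ ∣ ≡ j
          ∣at-n₀∣ j = ≡.cong ℤ.∣_∣ (cancel n₀ (+ j))
            where
            cancel : ∀ n k → n ℤ.+ k ℤ.- n ≡ k
            cancel = solve-∀
          j≤k : j ℕ.≤ k
          j≤k = ℤ.drop‿+≤+ (≡.subst₂ ℤ._≤_ (cancel n₀ (+ j)) (cancel n₀ (+ k)) (ℤ.+-monoʳ-≤ (ℤ.- n₀) n≤k))
            where
            cancel : ∀ n k → ℤ.- n ℤ.+ (n ℤ.+ k) ≡ k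
            cancel = solve-∀
          k∸j+1+j≡1+k : k ℕ.∸ j ℕ.+ suc j ≡ suc k
          k∸j+1+j≡1+k = ≡.trans (ℕ.+-suc (k ℕ.∸ j) j) (≡.cong suc (ℕ.m∸n+n≡m j≤k))

    ∙-quotient : P ∙ quotient ≈ₛ coeffP Q
    ∙-quotient n with below-or-from (n₀ ℤ.+ p₀) n
    ... | inj₁ n<n₀+p₀ = trans (∙-vanishesBelow P p₀P quotient-vanishesBelow n n<n₀+p₀)
      (sym (coeffP-vanishesBelow Q q₀Q n (ℤ.<-≤-trans n<n₀+p₀ (ℤ.≤-reflexive (cancel q₀ p₀)))))
      where
      cancel : ∀ q p → q ℤ.- p ℤ.+ p ≡ q
      cancel = solve-∀
    ... | inj₂ (k , ≡.refl) = begin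
      (P ∙ quotient) (n₀ ℤ.+ p₀ ℤ.+ + k)
        ≈⟨ ∙-local P p₀P (n₀ ℤ.+ p₀ ℤ.+ + k) (λ m m≤ → quotient≈approx k m (ℤ.≤-trans m≤ (ℤ.≤-reflexive (cancel n₀ p₀ (+ k))))) ⟩
      (P ∙ approx (suc k)) (n₀ ℤ.+ p₀ ℤ.+ + k)     ≡⟨ ≡.cong (P ∙ approx (suc k)) (swap n₀ p₀ (+ k)) ⟩
      (P ∙ approx (suc k)) (at k ℤ.+ p₀)           ≈⟨ approx-solves k ⟩
      coeffP Q (at k ℤ.+ p₀)                       ≡⟨ ≡.cong (coeffP Q) (≡.sym (swap n₀ p₀ (+ k))) ⟩
      coeffP Q (n₀ ℤ.+ p₀ ℤ.+ + k)                 ∎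
      where
      cancel : ∀ n p k → n ℤ.+ p ℤ.+ k ℤ.- p ≡ n ℤ.+ k
      cancel = solve-∀
      swap : ∀ n p k → n ℤ.+ p ℤ.+ k ≡ n ℤ.+ k ℤ.+ p
      swap = solve-∀

  -- The substitution ρ ↦ ρ⁻¹

  reflect : LPoly → LPoly
  reflect = map (λ t → ℤ.- proj₁ t , proj₂ t)

  reflect-∙ : ∀ p S n → (reflect p ∙ S) n ≈ (p ∙ (λ k → S (ℤ.- k))) (ℤ.- n)
  reflect-∙ []            S n = refl
  reflect-∙ ((e , a) ∷ p) S n = +-cong (*-congˡ (reflexive (≡.cong S (neg-distrib n e)))) (reflect-∙ p S n)
    where
    neg-distrib : ∀ n e → n ℤ.- ℤ.- e ≡ ℤ.- (ℤ.- n ℤ.- e)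
    neg-distrib = solve-∀

  reflect-⊗ : ∀ p q → reflect (p ⊗ q) ∼ reflect p ⊗ reflect q
  reflect-⊗ p q = mk∼ λ S n → let S⁻ = λ k → S (ℤ.- k) in begin
    (reflect (p ⊗ q) ∙ S) n                ≈⟨ reflect-∙ (p ⊗ q) S n ⟩
    ((p ⊗ q) ∙ S⁻) (ℤ.- n)                 ≈⟨ ⊗-∙ p q S⁻ (ℤ.- n) ⟩
    (p ∙ (q ∙ S⁻)) (ℤ.- n)                 ≈⟨ ∙-congʳ p (λ k → trans (reflexive (≡.cong (q ∙ S⁻) (≡.sym (ℤ.neg-involutive k))))
                                                                      (sym (reflect-∙ q S (ℤ.- k)))) (ℤ.- n) ⟩
    (p ∙ (λ k → (reflect q ∙ S) (ℤ.- k))) (ℤ.- n) ≈⟨ sym (reflect-∙ p (reflect q ∙ S) n) ⟩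
    (reflect p ∙ (reflect q ∙ S)) n        ≈⟨ sym (⊗-∙ (reflect p) (reflect q) S n) ⟩
    ((reflect p ⊗ reflect q) ∙ S) n        ∎

  coeffP-reflect-0 : ∀ p → coeffP (reflect p) (+ 0) ≈ coeffP p (+ 0)
  coeffP-reflect-0 p = begin
    coeffP (reflect p) (+ 0)     ≈⟨ coeffP≈∙δ (reflect p) (+ 0) ⟩
    (reflect p ∙ δ) (+ 0)        ≈⟨ reflect-∙ p δ (+ 0) ⟩
    (p ∙ (λ k → δ (ℤ.- k))) (+ 0) ≈⟨ ∙-congʳ p δ-neg (+ 0) ⟩
    (p ∙ δ) (+ 0)                ≈⟨ sym (coeffP≈∙δ p (+ 0)) ⟩
    coeffP p (+ 0)               ∎

  coeffP-symmetric-⊗-antisymmetric : ∀ p q → reflect p ∼ p → coeffP (p ⊗ (q ⊖ reflect q)) (+ 0) ≈ 0#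
  coeffP-symmetric-⊗-antisymmetric p q p-symmetric = begin
    coeffP (p ⊗ (q ⊖ reflect q)) (+ 0)
      ≈⟨ coeffP-cong (𝓛S.solve 3 (λ p q q′ → p :* (q :- q′) := p :* q :- p :* q′) 𝓛.refl p q (reflect q)) (+ 0) ⟩
    coeffP (p ⊗ q ⊖ p ⊗ reflect q) (+ 0)
      ≈⟨ coeffP-⊖ (p ⊗ q) (p ⊗ reflect q) (+ 0) ⟩
    coeffP (p ⊗ q) (+ 0) - coeffP (p ⊗ reflect q) (+ 0)
      ≈⟨ +-congˡ (-‿cong (coeffP-cong (𝓛.trans (⊗-congʳ (reflect q) (𝓛.sym p-symmetric))
                                               (𝓛.sym (reflect-⊗ p q))) (+ 0))) ⟩
    coeffP (p ⊗ q) (+ 0) - coeffP (reflect (p ⊗ q)) (+ 0)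
      ≈⟨ +-congˡ (-‿cong (coeffP-reflect-0 (p ⊗ q))) ⟩
    coeffP (p ⊗ q) (+ 0) - coeffP (p ⊗ q) (+ 0)
      ≈⟨ -‿inverseʳ _ ⟩
    0# ∎
    where open 𝓛S using (_:*_; _:-_; _:=_)

  IsLaurentSeries : Series → Set ℓ
  IsLaurentSeries = D.IsLaurentSeries R

  ∙-injective : ∀ {p₀ u} P → p₀ ≤ord P → coeffP P p₀ * u ≈ 1# →
                ∀ {S T} → IsLaurentSeries S → IsLaurentSeries T → P ∙ S ≈ₛ P ∙ T → S ≈ₛ T
  ∙-injective {p₀} P p₀P unit {S} {T} (_ , S₀) (_ , T₀) PS≈PT n = begin
    S n                  ≈⟨ KS.solve 2 (λ s t → s := (s :- t) :+ t) refl (S n) (T n) ⟩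
    (S n - T n) + T n    ≈⟨ +-congʳ (∙-vanishesBelow⁻¹ P p₀P unit (λ k → S k - T k) (vanishesBelow-sub S₀ T₀)
                                       P∙[S-T]≈0 n n<n+1+p₀-p₀) ⟩
    0# + T n             ≈⟨ +-identityˡ _ ⟩
    T n                  ∎
    where
    open KS using (solve; _:=_; _:-_; _:+_)
    P∙[S-T]≈0 : VanishesBelow (n ℤ.+ + 1 ℤ.+ p₀) (P ∙ (λ k → S k - T k))
    P∙[S-T]≈0 k _ = trans (∙-sub P S T k) (trans (+-congʳ (PS≈PT k)) (-‿inverseʳ _))
    n<n+1+p₀-p₀ : n < n ℤ.+ + 1 ℤ.+ p₀ ℤ.- p₀
    n<n+1+p₀-p₀ = ℤ.suc[i]≤j⇒i<j (ℤ.≤-reflexive (rearrange n p₀))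
      where
      rearrange : ∀ n p → + 1 ℤ.+ n ≡ n ℤ.+ + 1 ℤ.+ p ℤ.- p
      rearrange = solve-∀

module RingIdentities {c ℓ} (S : CommutativeRing c ℓ) where

  open import Data.Integer using (+_)
  open CommutativeRing S renaming (Carrier to A)
  open import Relation.Binary.Reasoning.Setoid setoid
  open IntegerCoefficientSolver S

  -- C = boundaryPoly ρ ρ⁻¹ (κ̂₁ + κ̂₂) κ̂₂ and C̄ = boundaryPoly ρ⁻¹ ρ (κ̂₁ + κ̂₂) κ̂₂; B, B̄ likewise.
  boundaryPoly : A → A → A → A → A
  boundaryPoly u v s t = u - s * v - t * (v * (v * v))

  -- Identities between Laurent polynomials in ρ = r, ρ⁻¹ = y are polynomial
  -- identities up to a multiple of r y - 1.
  modulo-ry : ∀ {r y P Q} W → r * y ≈ 1# → P ≈ Q + (r * y - 1#) * W → P ≈ Q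
  modulo-ry {r} {y} {P} {Q} W ry≈1 P≈ = begin
    P                        ≈⟨ P≈ ⟩
    Q + (r * y - 1#) * W     ≈⟨ +-congˡ (*-congʳ (trans (+-congʳ ry≈1) (-‿inverseʳ 1#))) ⟩
    Q + 0# * W               ≈⟨ +-congˡ (zeroˡ W) ⟩
    Q + 0#                   ≈⟨ +-identityʳ Q ⟩
    Q                        ∎

  module _ (r y : A) (ry≈1 : r * y ≈ 1#) where

    V₂-identity : ∀ k₁ k₂ →
      (r + y) * ((r + y) * (y - r)) - (k₁ + 1#) * (y - r)
        ≈ boundaryPoly y r (k₁ + k₂) k₂ * (y * y) - boundaryPoly r y (k₁ + k₂) k₂ * (r * r)
    V₂-identity k₁ k₂ = modulo-ry ((k₁ + 1# - k₂ * (r * y)) * (y - r)) ry≈1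
      (solve 4 (λ r y k₁ k₂ →
         (r :+ y) :* ((r :+ y) :* (y :- r)) :- (k₁ :+ con (+ 1)) :* (y :- r)
           := ((y :- (k₁ :+ k₂) :* r :- k₂ :* (r :* (r :* r))) :* (y :* y)
               :- (r :- (k₁ :+ k₂) :* y :- k₂ :* (y :* (y :* y))) :* (r :* r))
              :+ (r :* y :- con (+ 1)) :* ((k₁ :+ con (+ 1) :- k₂ :* (r :* y)) :* (y :- r)))
        refl r y k₁ k₂)

    V₃-identity : ∀ k₁ k₂ →
      (r + y) * (boundaryPoly y r (k₁ + k₂) k₂ * (y * y) - boundaryPoly r y (k₁ + k₂) k₂ * (r * r))
        - (k₂ + 1#) * ((r + y) * (y - r))
        ≈ boundaryPoly y r (k₁ + k₂) k₂ * (y * (y * y)) - boundaryPoly r y (k₁ + k₂) k₂ * (r * (r * r))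
    V₃-identity k₁ k₂ = modulo-ry ((k₂ + 1# + k₂ * (r * y)) * (y * y - r * r)) ry≈1
      (solve 4 (λ r y k₁ k₂ →
         (r :+ y) :* ((y :- (k₁ :+ k₂) :* r :- k₂ :* (r :* (r :* r))) :* (y :* y)
                      :- (r :- (k₁ :+ k₂) :* y :- k₂ :* (y :* (y :* y))) :* (r :* r))
           :- (k₂ :+ con (+ 1)) :* ((r :+ y) :* (y :- r))
           := ((y :- (k₁ :+ k₂) :* r :- k₂ :* (r :* (r :* r))) :* (y :* (y :* y))
               :- (r :- (k₁ :+ k₂) :* y :- k₂ :* (y :* (y :* y))) :* (r :* (r :* r)))
              :+ (r :* y :- con (+ 1)) :* ((k₂ :+ con (+ 1) :+ k₂ :* (r :* y)) :* (y :* y :- r :* r)))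
        refl r y k₁ k₂)

    top-identity : ∀ a b w₁ w₂ C C̄ →
      (r + y) * ((r + y) * (C̄ * (a * r) - C * (b * y))
                 - (w₂ + 1#) * (C̄ * (a * (r * r)) - C * (b * (y * y))))
        - (w₁ + 1#) * (C̄ * (a * r) - C * (b * y))
        ≈ - (C * (boundaryPoly r y (w₁ + w₂) w₂ * b) - C̄ * (boundaryPoly y r (w₁ + w₂) w₂ * a))
    top-identity a b w₁ w₂ C C̄ =
      modulo-ry (C̄ * a * (r + y - w₂ * r) - C * b * (r + y - w₂ * y)) ry≈1
      (solve 8 (λ r y a b w₁ w₂ C C̄ →
         (r :+ y) :* ((r :+ y) :* (C̄ :* (a :* r) :- C :* (b :* y))
                      :- (w₂ :+ con (+ 1)) :* (C̄ :* (a :* (r :* r)) :- C :* (b :* (y :* y))))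
           :- (w₁ :+ con (+ 1)) :* (C̄ :* (a :* r) :- C :* (b :* y))
           := :- (C :* ((r :- (w₁ :+ w₂) :* y :- w₂ :* (y :* (y :* y))) :* b)
                  :- C̄ :* ((y :- (w₁ :+ w₂) :* r :- w₂ :* (r :* (r :* r))) :* a))
              :+ (r :* y :- con (+ 1)) :* (C̄ :* a :* (r :+ y :- w₂ :* r) :- C :* b :* (r :+ y :- w₂ :* y)))
        refl r y a b w₁ w₂ C C̄)

  three-term-recurrence : ∀ r y C C̄ a b →
    (r + y) * (C̄ * a - C * b) ≈ (C̄ * (a * y) - C * (b * r)) + (C̄ * (a * r) - C * (b * y))
  three-term-recurrence = solve 6 (λ r y C C̄ a b →
    (r :+ y) :* (C̄ :* a :- C :* b) := (C̄ :* (a :* y) :- C :* (b :* r)) :+ (C̄ :* (a :* r) :- C :* (b :* y)))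
    refl

  cross-multiplication : ∀ A Ā B B̄ C C̄ a b →
    (C̄ * (B̄ * a)) * (A * (B * b) - Ā * (B̄ * a)) - (C * (B * b) - C̄ * (B̄ * a)) * ((B̄ * a) * Ā)
      ≈ (b * a) * (B * (B̄ * (A * C̄ - Ā * C)))
  cross-multiplication = solve 8 (λ A Ā B B̄ C C̄ a b →
    (C̄ :* (B̄ :* a)) :* (A :* (B :* b) :- Ā :* (B̄ :* a)) :- (C :* (B :* b) :- C̄ :* (B̄ :* a)) :* ((B̄ :* a) :* Ā)
      := (b :* a) :* (B :* (B̄ :* (A :* C̄ :- Ā :* C))))
    refl

module WeightedPaths {c ℓ} (R : CommutativeRing c ℓ) (L : ℕ) (κ₁ κ₂ ω₁ ω₂ : CommutativeRing.Carrier R) where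

  import Data.Nat.Properties as ℕ
  open import Data.List using (List; []; _∷_; _++_; map; foldr)
  open import Data.Maybe using (Maybe; just; nothing; fromMaybe)
  import Data.Maybe as Maybe
  open import Relation.Nullary using (yes; no; ¬_)
  open import Data.Empty using (⊥-elim)
  open import Relation.Binary.PropositionalEquality as ≡ using (_≡_)
  import Defs as D
  open D using (Step; up; down; allSteps)

  open CommutativeRing R renaming (Carrier to K)
  open import Relation.Binary.Reasoning.Setoid setoid

  d : ℕ → K
  d = D.downWeight R L κ₁ κ₂ ω₁ ω₂

  weight : ℕ → List Step → K
  weight h s = fromMaybe 0# (D.walk R L κ₁ κ₂ ω₁ ω₂ h s)

  sumOver : (List Step → K) → List (List Step) → K
  sumOver f = foldr (λ s acc → f s + acc) 0#

  W : ℕ → ℕ → K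
  W n h = sumOver (weight h) (allSteps n)

  sumOver-++ : ∀ f ss ts → sumOver f (ss ++ ts) ≈ sumOver f ss + sumOver f ts
  sumOver-++ f []       ts = sym (+-identityˡ _)
  sumOver-++ f (s ∷ ss) ts = trans (+-congˡ (sumOver-++ f ss ts)) (sym (+-assoc _ _ _))

  sumOver-map : ∀ f g ss → sumOver f (map g ss) ≈ sumOver (λ s → f (g s)) ss
  sumOver-map f g []       = refl
  sumOver-map f g (s ∷ ss) = +-congˡ (sumOver-map f g ss)

  sumOver-cong : ∀ {f g} ss → (∀ s → f s ≈ g s) → sumOver f ss ≈ sumOver g ss
  sumOver-cong []       f≈g = refl
  sumOver-cong (s ∷ ss) f≈g = +-cong (f≈g s) (sumOver-cong ss f≈g)

  sumOver-* : ∀ a f ss → sumOver (λ s → a * f s) ss ≈ a * sumOver f ss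
  sumOver-* a f []       = sym (zeroʳ a)
  sumOver-* a f (s ∷ ss) = trans (+-congˡ (sumOver-* a f ss)) (sym (distribˡ _ _ _))

  sumOver-0 : ∀ ss → sumOver (λ _ → 0#) ss ≈ 0#
  sumOver-0 []       = refl
  sumOver-0 (s ∷ ss) = trans (+-identityˡ _) (sumOver-0 ss)

  W-split : ∀ n h → W (suc n) h ≈ sumOver (λ s → weight h (up ∷ s)) (allSteps n)
                                 + sumOver (λ s → weight h (down ∷ s)) (allSteps n)
  W-split n h = trans (sumOver-++ (weight h) (map (up ∷_) (allSteps n)) (map (down ∷_) (allSteps n)))
                      (+-cong (sumOver-map (weight h) (up ∷_) (allSteps n))
                              (sumOver-map (weight h) (down ∷_) (allSteps n)))

  1*-fromMaybe : ∀ mw → fromMaybe 0# (Maybe.map (1# *_) mw) ≈ fromMaybe 0# mw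
  1*-fromMaybe (just w) = *-identityˡ w
  1*-fromMaybe nothing  = refl

  weight-up : ∀ h s → h ℕ.< L → weight h (up ∷ s) ≈ weight (suc h) s
  weight-up zero    s 0<L = up-step 0<L
    where
    up-step : 0 ℕ.< L → weight 0 (up ∷ s) ≈ weight 1 s
    up-step 0<L with 0 ℕ.<? L
    ... | no 0≮L = ⊥-elim (0≮L 0<L)
    ... | yes _  = 1*-fromMaybe (D.walk R L κ₁ κ₂ ω₁ ω₂ 1 s)
  weight-up (suc h) s h<L with suc h ℕ.<? L
  ... | no h≮L = ⊥-elim (h≮L h<L)
  ... | yes _  = 1*-fromMaybe (D.walk R L κ₁ κ₂ ω₁ ω₂ (suc (suc h)) s)

  weight-up-blocked : ∀ h s → ¬ h ℕ.< L → weight h (up ∷ s) ≈ 0#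
  weight-up-blocked zero    s 0≮L with 0 ℕ.<? L
  ... | yes 0<L = ⊥-elim (0≮L 0<L)
  ... | no _    = refl
  weight-up-blocked (suc h) s h≮L with suc h ℕ.<? L
  ... | yes h<L = ⊥-elim (h≮L h<L)
  ... | no _    = refl

  weight-down : ∀ h s → weight (suc h) (down ∷ s) ≈ d (suc h) * weight h s
  weight-down h s with D.walk R L κ₁ κ₂ ω₁ ω₂ h s
  ... | just w  = refl
  ... | nothing = sym (zeroʳ _)

  δ₀ : ℕ → K
  δ₀ zero    = 1#
  δ₀ (suc _) = 0#

  W-0 : ∀ h → W 0 h ≈ δ₀ h
  W-0 zero    = +-identityʳ 1#
  W-0 (suc h) = +-identityʳ 0#

  private
    ups downs : ℕ → ℕ → K
    ups   n h = sumOver (λ s → weight h (up ∷ s)) (allSteps n)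
    downs n h = sumOver (λ s → weight h (down ∷ s)) (allSteps n)

    ups-interior : ∀ n h → h ℕ.< L → ups n h ≈ W n (suc h)
    ups-interior n h h<L = sumOver-cong (allSteps n) (λ s → weight-up h s h<L)

    ups-top : ∀ n → ups n L ≈ 0#
    ups-top n = trans (sumOver-cong (allSteps n) (λ s → weight-up-blocked L s (ℕ.<-irrefl ≡.refl))) (sumOver-0 (allSteps n))

    downs-0 : ∀ n → downs n 0 ≈ 0#
    downs-0 n = sumOver-0 (allSteps n)

    downs-suc : ∀ n h → downs n (suc h) ≈ d (suc h) * W n h
    downs-suc n h = trans (sumOver-cong (allSteps n) (weight-down h)) (sumOver-* (d (suc h)) (weight h) (allSteps n))

  W-from-bottom : ∀ n → 0 ℕ.< L → W (suc n) 0 ≈ W n 1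
  W-from-bottom n 0<L = begin
    W (suc n) 0               ≈⟨ W-split n 0 ⟩
    ups n 0 + downs n 0       ≈⟨ +-cong (ups-interior n 0 0<L) (downs-0 n) ⟩
    W n 1 + 0#                ≈⟨ +-identityʳ _ ⟩
    W n 1                     ∎

  W-from-interior : ∀ n h → suc h ℕ.< L → W (suc n) (suc h) ≈ W n (suc (suc h)) + d (suc h) * W n h
  W-from-interior n h h<L = trans (W-split n (suc h)) (+-cong (ups-interior n (suc h) h<L) (downs-suc n h))

  W-from-top : ∀ n h → suc h ≡ L → W (suc n) (suc h) ≈ d (suc h) * W n h
  W-from-top n h ≡.refl = begin
    W (suc n) L               ≈⟨ W-split n L ⟩
    ups n L + downs n L       ≈⟨ +-cong (ups-top n) (downs-suc n h) ⟩
    0# + d L * W n h          ≈⟨ +-identityˡ _ ⟩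
    d L * W n h               ∎

module Theorem6Proof {c ℓ} (R : CommutativeRing c ℓ) (m : ℕ)
                     (κ₁ κ₂ ω₁ ω₂ : CommutativeRing.Carrier R) where

  import Data.Nat.Properties as ℕ
  open import Data.Integer as ℤ using (ℤ; +_; -[1+_]; _≤_; _<_; -≤-; -≤+; +≤+; -<-; -<+; +<+)
  import Data.Integer.Properties as ℤ
  open import Data.Integer.Tactic.RingSolver using (solve-∀)
  open import Data.List.Relation.Unary.All using ([]; _∷_)
  open import Data.Product using (_×_; _,_; proj₁; proj₂)
  open import Data.Sum using (_⊎_; inj₁; inj₂)
  open import Data.Empty using (⊥-elim)
  open import Relation.Binary.PropositionalEquality as ≡ using (_≡_)
  open import Relation.Nullary using (yes; no)
  import Defs as D

  open CommutativeRing R renaming (Carrier to K) hiding (zero)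
  open LaurentPolynomials R
  open import Relation.Binary.Reasoning.Setoid setoid

  L : ℕ
  L = 4 ℕ.+ m

  open D.Thm6 R L κ₁ κ₂ ω₁ ω₂

  open WeightedPaths R L κ₁ κ₂ ω₁ ω₂ using (d; δ₀; W; W-0; W-from-bottom; W-from-interior; W-from-top)

  d-interior : ∀ j → suc j ℕ.≤ m → d (3 ℕ.+ j) ≡ 1#
  d-interior j j<m with 3 ℕ.+ j ℕ.≟ 1 | 3 ℕ.+ j ℕ.≟ 2 | 3 ℕ.+ j ℕ.≟ 3 ℕ.+ m | 3 ℕ.+ j ℕ.≟ L
  ... | no _ | no _ | no _      | no _      = ≡.refl
  ... | no _ | no _ | yes j≡m   | _         = ⊥-elim (ℕ.<-irrefl (ℕ.+-cancelˡ-≡ 3 j m j≡m) j<m)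
  ... | no _ | no _ | no _      | yes j≡1+m = ⊥-elim (ℕ.<-irrefl (ℕ.+-cancelˡ-≡ 3 j (suc m) j≡1+m) (ℕ.m<n⇒m<1+n j<m))

  d-L-1 : d (3 ℕ.+ m) ≡ ω₂
  d-L-1 with 3 ℕ.+ m ℕ.≟ 1 | 3 ℕ.+ m ℕ.≟ 2 | 3 ℕ.+ m ℕ.≟ 3 ℕ.+ m
  ... | no _ | no _ | yes _  = ≡.refl
  ... | no _ | no _ | no m≢m = ⊥-elim (m≢m ≡.refl)

  d-L : d L ≡ ω₁
  d-L with L ℕ.≟ 1 | L ℕ.≟ 2 | L ℕ.≟ 3 ℕ.+ m | L ℕ.≟ L
  ... | no _ | no _ | yes L≡L-1 | _      = ⊥-elim (ℕ.1+n≢n L≡L-1)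
  ... | no _ | no _ | no _      | yes _  = ≡.refl
  ... | no _ | no _ | no _      | no L≢L = ⊥-elim (L≢L ≡.refl)

  open RingIdentities laurentRing

  r y x Y : LPoly
  r = X (+ 1)
  y = X -[1+ 0 ]
  x = r ⊕ y
  Y = y ⊖ r

  X-≡ : ∀ {e f} → e ≡ f → X e ∼ X f
  X-≡ e≡f = 𝓛.reflexive (≡.cong X e≡f)

  ry≈1 : r ⊗ y ∼ 𝟙
  ry≈1 = 𝓛.sym (X-+ (+ 1) -[1+ 0 ])

  X-cube : ∀ e → X (e ℤ.+ (e ℤ.+ e)) ∼ X e ⊗ (X e ⊗ X e)
  X-cube e = 𝓛.trans (X-+ e (e ℤ.+ e)) (⊗-congˡ (X e) (X-+ e e))

  boundaryPoly≈ : ∀ e a b →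
    (X (ℤ.- e) ⊖ mono e (a + b)) ⊖ mono (e ℤ.+ (e ℤ.+ e)) b
      ∼ boundaryPoly (X (ℤ.- e)) (X e) (const a ⊕ const b) (const b)
  boundaryPoly≈ e a b = ⊖-cong (⊖-congˡ (X (ℤ.- e)) lower) cubic
    where
    lower : mono e (a + b) ∼ (const a ⊕ const b) ⊗ X e
    lower = 𝓛.trans (mono≈const⊗X e (a + b)) (⊗-congʳ (X e) (const-+ a b))
    cubic : mono (e ℤ.+ (e ℤ.+ e)) b ∼ const b ⊗ (X e ⊗ (X e ⊗ X e))
    cubic = 𝓛.trans (mono≈const⊗X _ b) (⊗-congˡ (const b) (X-cube e))

  k̂₁ k̂₂ ŵ₁ ŵ₂ : LPoly
  k̂₁ = const κ̂₁
  k̂₂ = const κ̂₂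
  ŵ₁ = const ω̂₁
  ŵ₂ = const ω̂₂

  C≈ : C ∼ boundaryPoly r y (k̂₁ ⊕ k̂₂) k̂₂
  C≈ = boundaryPoly≈ -[1+ 0 ] κ̂₁ κ̂₂

  C̄≈ : C̄ ∼ boundaryPoly y r (k̂₁ ⊕ k̂₂) k̂₂
  C̄≈ = boundaryPoly≈ (+ 1) κ̂₁ κ̂₂

  B≈ : B ∼ boundaryPoly r y (ŵ₁ ⊕ ŵ₂) ŵ₂
  B≈ = boundaryPoly≈ -[1+ 0 ] ω̂₁ ω̂₂

  B̄≈ : B̄ ∼ boundaryPoly y r (ŵ₁ ⊕ ŵ₂) ŵ₂
  B̄≈ = boundaryPoly≈ (+ 1) ω̂₁ ω̂₂

  const≈hat⊕𝟙 : ∀ a → const a ∼ const (a - 1#) ⊕ 𝟙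
  const≈hat⊕𝟙 a = 𝓛.trans (const-cong (KS.solve 1 (λ a → a := (a :- con (+ 1)) :+ con (+ 1)) refl a))
                           (const-+ (a - 1#) 1#)
    where open KS

  ρᴸ ρ⁻ᴸ : LPoly
  ρᴸ = X (+ L)
  ρ⁻ᴸ = X (ℤ.- + L)

  -1≤ord-C̄ : -[1+ 0 ] ≤ord C̄
  -1≤ord-C̄ = ℤ.≤-refl ∷ -≤+ ∷ -≤+ ∷ []

  -1≤ord-B̄ : -[1+ 0 ] ≤ord B̄
  -1≤ord-B̄ = ℤ.≤-refl ∷ -≤+ ∷ -≤+ ∷ []

  -3≤ord-C : -[1+ 2 ] ≤ord C
  -3≤ord-C = -≤+ ∷ -≤- ℕ.z≤n ∷ ℤ.≤-refl ∷ []

  -3≤ord-B : -[1+ 2 ] ≤ord B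
  -3≤ord-B = -≤+ ∷ -≤- ℕ.z≤n ∷ ℤ.≤-refl ∷ []

  -2≤ord-A : -[1+ 1 ] ≤ord A
  -2≤ord-A = -≤+ ∷ ℤ.≤-refl ∷ []

  0≤ord-Ā : + 0 ≤ord Ā
  0≤ord-Ā = ℤ.≤-refl ∷ +≤+ ℕ.z≤n ∷ []

  4≤ord-ρᴸ : + 4 ≤ord ρᴸ
  4≤ord-ρᴸ = +≤+ (ℕ.m≤m+n 4 m) ∷ []

  -L≤ord-ρ⁻ᴸ : ℤ.- + L ≤ord ρ⁻ᴸ
  -L≤ord-ρ⁻ᴸ = ℤ.≤-refl ∷ []

  -- Coefficients of these concrete polynomials compute to sums of 0#'s and one entry.
  coeffP-C̄-lowest : coeffP C̄ -[1+ 0 ] ≈ 1#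
  coeffP-C̄-lowest = KS.solve 0 (con (+ 1) :+ (con (+ 0) :+ (con (+ 0) :+ con (+ 0))) := con (+ 1)) refl
    where open KS

  coeffP-B̄-lowest : coeffP B̄ -[1+ 0 ] ≈ 1#
  coeffP-B̄-lowest = coeffP-C̄-lowest

  coeffP-C-lowest : coeffP C -[1+ 2 ] ≈ - κ̂₂
  coeffP-C-lowest = KS.solve 1 (λ k → con (+ 0) :+ (con (+ 0) :+ (:- k :+ con (+ 0))) := :- k) refl κ̂₂
    where open KS

  coeffP-A-lowest : coeffP A -[1+ 1 ] ≈ - κ̂₂
  coeffP-A-lowest = KS.solve 1 (λ k → con (+ 0) :+ (:- k :+ con (+ 0)) := :- k) refl κ̂₂
    where open KS

  coeffP-Ā-0 : coeffP Ā (+ 0) ≈ 1#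
  coeffP-Ā-0 = KS.solve 0 (con (+ 1) :+ (con (+ 0) :+ con (+ 0)) := con (+ 1)) refl
    where open KS

  coeffP-Ā-1 : coeffP Ā (+ 1) ≈ 0#
  coeffP-Ā-1 = KS.solve 0 (con (+ 0) :+ (con (+ 0) :+ con (+ 0)) := con (+ 0)) refl
    where open KS

  coeffP-Ā-2 : coeffP Ā (+ 2) ≈ - κ̂₂
  coeffP-Ā-2 = coeffP-A-lowest

  coeffP-Ā-3+ : ∀ k → coeffP Ā (+ (3 ℕ.+ k)) ≈ 0#
  coeffP-Ā-3+ k = coeffP-Ā-1

  M P₊ P₋ : LPoly
  M = A ⊗ (B ⊗ ρᴸ) ⊖ Ā ⊗ (B̄ ⊗ ρ⁻ᴸ)
  P₊ = C ⊗ (B ⊗ ρᴸ)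
  P₋ = C̄ ⊗ (B̄ ⊗ ρ⁻ᴸ)

  ord-D : ℤ
  ord-D = -[1+ 0 ] ℤ.+ (-[1+ 0 ] ℤ.+ ℤ.- + L)

  ord-D≤ord-P₋ : ord-D ≤ord P₋
  ord-D≤ord-P₋ = ≤ord-⊗ -1≤ord-C̄ (≤ord-⊗ -1≤ord-B̄ -L≤ord-ρ⁻ᴸ)

  -2≤ord-P₊ : -[1+ 1 ] ≤ord P₊
  -2≤ord-P₊ = ≤ord-⊗ -3≤ord-C (≤ord-⊗ -3≤ord-B 4≤ord-ρᴸ)

  ord-D≤ord-denominator : ord-D ≤ord denominator
  ord-D≤ord-denominator = ≤ord-⊖ (≤ord-weaken (-≤- (ℕ.s≤s ℕ.z≤n)) -2≤ord-P₊) ord-D≤ord-P₋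

  coeffP-P₋-lowest : coeffP P₋ ord-D ≈ 1#
  coeffP-P₋-lowest = begin
    coeffP P₋ ord-D
      ≈⟨ coeffP-⊗-lowest C̄ (B̄ ⊗ ρ⁻ᴸ) -1≤ord-C̄ (≤ord-⊗ -1≤ord-B̄ -L≤ord-ρ⁻ᴸ) ⟩
    coeffP C̄ -[1+ 0 ] * coeffP (B̄ ⊗ ρ⁻ᴸ) (-[1+ 0 ] ℤ.+ ℤ.- + L)
      ≈⟨ *-cong coeffP-C̄-lowest (coeffP-⊗-lowest B̄ ρ⁻ᴸ -1≤ord-B̄ -L≤ord-ρ⁻ᴸ) ⟩
    1# * (coeffP B̄ -[1+ 0 ] * coeffP ρ⁻ᴸ (ℤ.- + L))
      ≈⟨ *-congˡ (*-cong coeffP-B̄-lowest coeffP-ρ⁻ᴸ) ⟩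
    1# * (1# * 1#)
      ≈⟨ trans (*-identityˡ _) (*-identityˡ _) ⟩
    1# ∎
    where
    coeffP-ρ⁻ᴸ : coeffP ρ⁻ᴸ (ℤ.- + L) ≈ 1#
    coeffP-ρ⁻ᴸ = trans (coeffP≈∙δ ρ⁻ᴸ (ℤ.- + L)) (trans (X-∙ (ℤ.- + L) δ (ℤ.- + L)) (δ-i-i (ℤ.- + L)))

  coeffP-denominator-lowest : coeffP denominator ord-D ≈ - 1#
  coeffP-denominator-lowest = begin
    coeffP denominator ord-D            ≈⟨ coeffP-⊖ P₊ P₋ ord-D ⟩
    coeffP P₊ ord-D - coeffP P₋ ord-D   ≈⟨ +-cong (coeffP-vanishesBelow P₊ -2≤ord-P₊ ord-D (-<- (ℕ.s≤s (ℕ.s≤s ℕ.z≤n))))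
                                                  (-‿cong coeffP-P₋-lowest) ⟩
    0# - 1#                             ≈⟨ +-identityˡ _ ⟩
    - 1#                                ∎

  denominator-unit : coeffP denominator ord-D * - 1# ≈ 1#
  denominator-unit = trans (*-congʳ coeffP-denominator-lowest)
    (KS.solve 0 (:- con (+ 1) :* :- con (+ 1) := con (+ 1)) refl)
    where open KS

  ord-M : ℤ
  ord-M = + 0 ℤ.+ (-[1+ 0 ] ℤ.+ ℤ.- + L)

  ord-M≤ord-M : ord-M ≤ord M
  ord-M≤ord-M = ≤ord-⊖ (≤ord-weaken (-≤- ℕ.z≤n) (≤ord-⊗ -2≤ord-A (≤ord-⊗ -3≤ord-B 4≤ord-ρᴸ)))
                       (≤ord-⊗ 0≤ord-Ā (≤ord-⊗ -1≤ord-B̄ -L≤ord-ρ⁻ᴸ))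

  module F = Quotient denominator ord-D≤ord-denominator denominator-unit M ord-M≤ord-M

  F : Series
  F = F.quotient

  module G = Quotient C̄ -1≤ord-C̄ (trans (*-identityʳ _) coeffP-C̄-lowest) Ā 0≤ord-Ā

  G : Series
  G = G.quotient

  G-vanishesBelow : VanishesBelow (+ 1) G
  G-vanishesBelow = G.quotient-vanishesBelow

  G-1 : G (+ 1) ≈ 1#
  G-1 = begin
    G (+ 1)                          ≈⟨ sym (*-identityˡ _) ⟩
    1# * G (+ 1)                     ≈⟨ *-congʳ (sym coeffP-C̄-lowest) ⟩
    coeffP C̄ -[1+ 0 ] * G (+ 1)      ≈⟨ sym (∙-lowest C̄ -1≤ord-C̄ G-vanishesBelow) ⟩
    (C̄ ∙ G) (+ 0)                    ≈⟨ G.∙-quotient (+ 0) ⟩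
    coeffP Ā (+ 0)                   ≈⟨ coeffP-Ā-0 ⟩
    1#                               ∎

  G-2 : G (+ 2) ≈ 0#
  G-2 = begin
    G (+ 2)                          ≈⟨ KS.solve 3 (λ k s t → k := con (+ 1) :* k :+ (:- s :* con (+ 0) :+ (:- t :* con (+ 0) :+ con (+ 0)))) refl (G (+ 2)) (κ̂₁ + κ̂₂) κ̂₂ ⟩
    1# * G (+ 2) + (- (κ̂₁ + κ̂₂) * 0# + (- κ̂₂ * 0# + 0#))
                                     ≈⟨ +-congˡ (+-cong (*-congˡ (sym (G-vanishesBelow (+ 0) (+<+ (ℕ.s≤s ℕ.z≤n)))))
                                                        (+-congʳ (*-congˡ (sym (G-vanishesBelow -[1+ 1 ] -<+))))) ⟩
    (C̄ ∙ G) (+ 1)                    ≈⟨ G.∙-quotient (+ 1) ⟩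
    coeffP Ā (+ 1)                   ≈⟨ coeffP-Ā-1 ⟩
    0#                               ∎
    where open KS

  -- F and G agree below 2L - 2

  W₀ Q : LPoly
  W₀ = A ⊗ C̄ ⊖ Ā ⊗ C
  Q = B ⊗ (B̄ ⊗ W₀)

  -3≤ord-W₀ : -[1+ 2 ] ≤ord W₀
  -3≤ord-W₀ = ≤ord-⊖ (≤ord-⊗ -2≤ord-A -1≤ord-C̄) (≤ord-⊗ 0≤ord-Ā -3≤ord-C)

  -- D F = M and C̄ G = Ā, so P₋ D (F - G) = P₋ M - D B̄ ρ⁻ᴸ Ā, which is Q.
  P₋⊗D∙[F-G] : (P₋ ⊗ denominator) ∙ (λ k → F k - G k) ≈ₛ coeffP Q
  P₋⊗D∙[F-G] n = begin
    ((P₋ ⊗ denominator) ∙ (λ k → F k - G k)) n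
      ≈⟨ ∙-sub (P₋ ⊗ denominator) F G n ⟩
    ((P₋ ⊗ denominator) ∙ F) n - ((P₋ ⊗ denominator) ∙ G) n
      ≈⟨ +-cong (∙-expansion-⊗ P₋ denominator F M F.∙-quotient n) (-‿cong (∙-∼ (𝓛.*-comm P₋ denominator) G n)) ⟩
    coeffP (P₋ ⊗ M) n - ((denominator ⊗ P₋) ∙ G) n
      ≈⟨ +-congˡ (-‿cong (∙-expansion-⊗ denominator P₋ G ((B̄ ⊗ ρ⁻ᴸ) ⊗ Ā) P₋∙G n)) ⟩
    coeffP (P₋ ⊗ M) n - coeffP (denominator ⊗ ((B̄ ⊗ ρ⁻ᴸ) ⊗ Ā)) n
      ≈⟨ sym (coeffP-⊖ (P₋ ⊗ M) (denominator ⊗ ((B̄ ⊗ ρ⁻ᴸ) ⊗ Ā)) n) ⟩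
    coeffP (P₋ ⊗ M ⊖ denominator ⊗ ((B̄ ⊗ ρ⁻ᴸ) ⊗ Ā)) n
      ≈⟨ coeffP-cong (𝓛.trans (cross-multiplication A Ā B B̄ C C̄ ρ⁻ᴸ ρᴸ)
                              (𝓛.trans (⊗-congʳ Q ρᴸρ⁻ᴸ≈1) (𝓛.*-identityˡ Q))) n ⟩
    coeffP Q n ∎
    where
    ρᴸρ⁻ᴸ≈1 : ρᴸ ⊗ ρ⁻ᴸ ∼ 𝟙
    ρᴸρ⁻ᴸ≈1 = 𝓛.trans (𝓛.sym (X-+ (+ L) (ℤ.- + L))) (X-≡ (ℤ.+-inverseʳ (+ L)))
    P₋∙G : P₋ ∙ G ≈ₛ coeffP ((B̄ ⊗ ρ⁻ᴸ) ⊗ Ā)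
    P₋∙G k = trans (∙-∼ (𝓛.*-comm C̄ (B̄ ⊗ ρ⁻ᴸ)) G k) (∙-expansion-⊗ (B̄ ⊗ ρ⁻ᴸ) C̄ G Ā G.∙-quotient k)

  -- The lowest terms of A C̄ and Ā C cancel.
  Q-vanishesBelow : VanishesBelow -[1+ 5 ] (coeffP Q)
  Q-vanishesBelow n n<-6 with n ℤ.≟ -[1+ 6 ]
  ... | yes ≡.refl = begin
    coeffP Q -[1+ 6 ]
      ≈⟨ coeffP-⊗-lowest B (B̄ ⊗ W₀) -3≤ord-B (≤ord-⊗ -1≤ord-B̄ -3≤ord-W₀) ⟩
    coeffP B -[1+ 2 ] * coeffP (B̄ ⊗ W₀) -[1+ 3 ]
      ≈⟨ *-congˡ (coeffP-⊗-lowest B̄ W₀ -1≤ord-B̄ -3≤ord-W₀) ⟩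
    coeffP B -[1+ 2 ] * (coeffP B̄ -[1+ 0 ] * coeffP W₀ -[1+ 2 ])
      ≈⟨ *-congˡ (*-congˡ W₀-lowest) ⟩
    coeffP B -[1+ 2 ] * (coeffP B̄ -[1+ 0 ] * 0#)
      ≈⟨ trans (*-congˡ (zeroʳ _)) (zeroʳ _) ⟩
    0# ∎
    where
    W₀-lowest : coeffP W₀ -[1+ 2 ] ≈ 0#
    W₀-lowest = begin
      coeffP W₀ -[1+ 2 ]
        ≈⟨ coeffP-⊖ (A ⊗ C̄) (Ā ⊗ C) -[1+ 2 ] ⟩
      coeffP (A ⊗ C̄) -[1+ 2 ] - coeffP (Ā ⊗ C) -[1+ 2 ]
        ≈⟨ +-cong (coeffP-⊗-lowest A C̄ -2≤ord-A -1≤ord-C̄) (-‿cong (coeffP-⊗-lowest Ā C 0≤ord-Ā -3≤ord-C)) ⟩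
      coeffP A -[1+ 1 ] * coeffP C̄ -[1+ 0 ] - coeffP Ā (+ 0) * coeffP C -[1+ 2 ]
        ≈⟨ +-cong (*-cong coeffP-A-lowest coeffP-C̄-lowest) (-‿cong (*-cong coeffP-Ā-0 coeffP-C-lowest)) ⟩
      - κ̂₂ * 1# - 1# * - κ̂₂
        ≈⟨ KS.solve 1 (λ k → :- k :* con (+ 1) :- con (+ 1) :* :- k := con (+ 0)) refl κ̂₂ ⟩
      0# ∎
      where open KS
  ... | no n≢-7 = coeffP-vanishesBelow Q (≤ord-⊗ -3≤ord-B (≤ord-⊗ -1≤ord-B̄ -3≤ord-W₀)) n
                    (ℤ.≤∧≢⇒< (ℤ.i<j⇒i≤pred[j] n<-6) n≢-7)

  F-G-vanishesBelow : VanishesBelow (-[1+ 5 ] ℤ.- (ord-D ℤ.+ ord-D)) (λ k → F k - G k)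
  F-G-vanishesBelow = ∙-vanishesBelow⁻¹ (P₋ ⊗ denominator) (≤ord-⊗ ord-D≤ord-P₋ ord-D≤ord-denominator)
    unit (λ k → F k - G k) (vanishesBelow-sub F.quotient-vanishesBelow G-vanishesBelow) (λ n n<-6 → trans (P₋⊗D∙[F-G] n) (Q-vanishesBelow n n<-6))
    where
    unit : coeffP (P₋ ⊗ denominator) (ord-D ℤ.+ ord-D) * - 1# ≈ 1#
    unit = begin
      coeffP (P₋ ⊗ denominator) (ord-D ℤ.+ ord-D) * - 1#
        ≈⟨ *-congʳ (coeffP-⊗-lowest P₋ denominator ord-D≤ord-P₋ ord-D≤ord-denominator) ⟩
      coeffP P₋ ord-D * coeffP denominator ord-D * - 1#
        ≈⟨ *-congʳ (trans (*-congʳ coeffP-P₋-lowest) (*-identityˡ _)) ⟩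
      coeffP denominator ord-D * - 1#
        ≈⟨ denominator-unit ⟩
      1# ∎

  -- The Laurent polynomials V h = (ρ⁻¹ - ρ) Pₕ(ρ + ρ⁻¹)

  -- The recurrence is that of the transfer matrix: x V h = V (h+1) + d h V (h-1).
  -- Used only through its defining equations: unfolding V at the symbolic height L
  -- produces huge terms.
  opaque
    V : ℕ → LPoly
    V zero          = Y
    V (suc zero)    = x ⊗ Y
    V (suc (suc h)) = x ⊗ V (suc h) ⊖ const (d (suc h)) ⊗ V h

    V-0 : V 0 ≡ Y
    V-0 = ≡.refl

    V-1 : V 1 ≡ x ⊗ V 0
    V-1 = ≡.refl

    V-suc-suc : ∀ h → V (suc (suc h)) ≡ x ⊗ V (suc h) ⊖ const (d (suc h)) ⊗ V h
    V-suc-suc h = ≡.refl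

  V-1≈ : V 1 ∼ x ⊗ Y
  V-1≈ = 𝓛.reflexive (≡.trans V-1 (≡.cong (x ⊗_) V-0))

  -- Away from both walls all weights are 1 and V h takes this form.
  Vᵇ : ℕ → LPoly
  Vᵇ k = C̄ ⊗ X (ℤ.- + k) ⊖ C ⊗ X (+ k)

  X-neg-suc : ∀ k → X (ℤ.- + suc k) ∼ X (ℤ.- + k) ⊗ y
  X-neg-suc zero    = X-+ (+ 0) -[1+ 0 ]
  X-neg-suc (suc k) = 𝓛.trans (X-≡ (≡.cong (λ i → -[1+ suc i ]) (≡.sym (ℕ.+-identityʳ k)))) (X-+ -[1+ k ] -[1+ 0 ])

  X-pos-suc : ∀ k → X (+ suc k) ∼ X (+ k) ⊗ r
  X-pos-suc k = 𝓛.trans (X-≡ (≡.cong +_ (ℕ.+-comm 1 k))) (X-+ (+ k) (+ 1))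

  X-neg≈X-neg-suc⊗r : ∀ k → X (ℤ.- + k) ∼ X (ℤ.- + suc k) ⊗ r
  X-neg≈X-neg-suc⊗r zero    = X-+ -[1+ 0 ] (+ 1)
  X-neg≈X-neg-suc⊗r (suc k) = X-+ -[1+ suc k ] (+ 1)

  X-pos≈X-pos-suc⊗y : ∀ k → X (+ k) ∼ X (+ suc k) ⊗ y
  X-pos≈X-pos-suc⊗y k = X-+ (+ suc k) -[1+ 0 ]

  Vᵇ-recurrence : ∀ k → x ⊗ Vᵇ (suc k) ∼ Vᵇ (suc (suc k)) ⊕ Vᵇ k
  Vᵇ-recurrence k = 𝓛.trans (three-term-recurrence r y C C̄ (X (ℤ.- + suc k)) (X (+ suc k)))
    (𝓛.sym (𝓛.+-cong (⊖-cong (⊗-congˡ C̄ (X-neg-suc (suc k))) (⊗-congˡ C (X-pos-suc (suc k))))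
                     (⊖-cong (⊗-congˡ C̄ (X-neg≈X-neg-suc⊗r k)) (⊗-congˡ C (X-pos≈X-pos-suc⊗y k)))))

  Cᵨ C̄ᵨ : LPoly
  Cᵨ = boundaryPoly r y (k̂₁ ⊕ k̂₂) k̂₂
  C̄ᵨ = boundaryPoly y r (k̂₁ ⊕ k̂₂) k̂₂

  Vᵇ₂≈ : Vᵇ 2 ∼ C̄ᵨ ⊗ (y ⊗ y) ⊖ Cᵨ ⊗ (r ⊗ r)
  Vᵇ₂≈ = ⊖-cong (𝓛.*-cong C̄≈ (X-+ -[1+ 0 ] -[1+ 0 ])) (𝓛.*-cong C≈ (X-+ (+ 1) (+ 1)))

  V₂≈Vᵇ₂ : V 2 ∼ Vᵇ 2
  V₂≈Vᵇ₂ = 𝓛.trans (𝓛.reflexive (V-suc-suc 0))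
          (𝓛.trans (⊖-cong (⊗-congˡ x V-1≈) (𝓛.*-cong (const≈hat⊕𝟙 κ₁) (𝓛.reflexive V-0)))
          (𝓛.trans (V₂-identity r y ry≈1 k̂₁ k̂₂) (𝓛.sym Vᵇ₂≈)))

  V₃≈Vᵇ₃ : V 3 ∼ Vᵇ 3
  V₃≈Vᵇ₃ = 𝓛.trans (𝓛.reflexive (V-suc-suc 1))
          (𝓛.trans (⊖-cong (⊗-congˡ x (𝓛.trans V₂≈Vᵇ₂ Vᵇ₂≈)) (𝓛.*-cong (const≈hat⊕𝟙 κ₂) V-1≈))
          (𝓛.trans (V₃-identity r y ry≈1 k̂₁ k̂₂)
                   (𝓛.sym (⊖-cong (𝓛.*-cong C̄≈ (X-cube -[1+ 0 ])) (𝓛.*-cong C≈ (X-cube (+ 1)))))))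

  V≈Vᵇ : ∀ j → j ℕ.≤ suc m → V (2 ℕ.+ j) ∼ Vᵇ (2 ℕ.+ j)
  V≈Vᵇ zero    _           = V₂≈Vᵇ₂
  V≈Vᵇ (suc j) (ℕ.s≤s j≤m) = proj₂ (consecutive j j≤m)
    where
    consecutive : ∀ j → j ℕ.≤ m → V (2 ℕ.+ j) ∼ Vᵇ (2 ℕ.+ j) × V (3 ℕ.+ j) ∼ Vᵇ (3 ℕ.+ j)
    consecutive zero    _   = V₂≈Vᵇ₂ , V₃≈Vᵇ₃
    consecutive (suc j) j<m with consecutive j (ℕ.<⇒≤ j<m)
    ... | V₂₊ⱼ≈ , V₃₊ⱼ≈ = V₃₊ⱼ≈ , 𝓛.trans (𝓛.reflexive (V-suc-suc (2 ℕ.+ j))) (𝓛.trans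
      (⊖-cong (⊗-congˡ x V₃₊ⱼ≈) (𝓛.trans (⊗-congʳ (V (2 ℕ.+ j)) (const-cong (reflexive (d-interior j j<m))))
                                        (𝓛.trans (𝓛.*-identityˡ _) V₂₊ⱼ≈)))
      (𝓛.trans (⊖-congʳ (Vᵇ (2 ℕ.+ j)) (Vᵇ-recurrence (2 ℕ.+ j))) (p⊕q⊖q∼p (Vᵇ (4 ℕ.+ j)) (Vᵇ (2 ℕ.+ j)))))

  V-top : V (suc L) ∼ ⊝ denominator
  V-top = 𝓛.trans (𝓛.reflexive (V-suc-suc (3 ℕ.+ m))) (𝓛.trans
    (⊖-cong (⊗-congˡ x (𝓛.trans (𝓛.reflexive (V-suc-suc (2 ℕ.+ m))) (⊖-cong (⊗-congˡ x V-L-1≈) (𝓛.*-cong (𝓛.trans (const-cong (reflexive d-L-1)) (const≈hat⊕𝟙 ω₂)) V-L-2≈))))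
            (𝓛.*-cong (𝓛.trans (const-cong (reflexive d-L)) (const≈hat⊕𝟙 ω₁)) V-L-1≈))
    (𝓛.trans (top-identity r y ry≈1 ρ⁻ᴸ ρᴸ ŵ₁ ŵ₂ C C̄)
             (𝓛.-‿cong (𝓛.sym (⊖-cong (⊗-congˡ C (⊗-congʳ ρᴸ B≈)) (⊗-congˡ C̄ (⊗-congʳ ρ⁻ᴸ B̄≈)))))))
    where
    V-L-1≈ : V (3 ℕ.+ m) ∼ C̄ ⊗ (ρ⁻ᴸ ⊗ r) ⊖ C ⊗ (ρᴸ ⊗ y)
    V-L-1≈ = 𝓛.trans (V≈Vᵇ (suc m) ℕ.≤-refl)
      (⊖-cong (⊗-congˡ C̄ (X-neg≈X-neg-suc⊗r (3 ℕ.+ m))) (⊗-congˡ C (X-pos≈X-pos-suc⊗y (3 ℕ.+ m))))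
    V-L-2≈ : V (2 ℕ.+ m) ∼ C̄ ⊗ (ρ⁻ᴸ ⊗ (r ⊗ r)) ⊖ C ⊗ (ρᴸ ⊗ (y ⊗ y))
    V-L-2≈ = 𝓛.trans (V≈Vᵇ m (ℕ.n≤1+n m)) (⊖-cong (⊗-congˡ C̄ ρ⁻⁽ᴸ⁻²⁾≈) (⊗-congˡ C ρᴸ⁻²≈))
      where
      ρ⁻⁽ᴸ⁻²⁾≈ : X (ℤ.- + (2 ℕ.+ m)) ∼ ρ⁻ᴸ ⊗ (r ⊗ r)
      ρ⁻⁽ᴸ⁻²⁾≈ = 𝓛.trans (X-neg≈X-neg-suc⊗r (2 ℕ.+ m))
        (𝓛.trans (⊗-congʳ r (X-neg≈X-neg-suc⊗r (3 ℕ.+ m))) (𝓛.*-assoc ρ⁻ᴸ r r))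
      ρᴸ⁻²≈ : X (+ (2 ℕ.+ m)) ∼ ρᴸ ⊗ (y ⊗ y)
      ρᴸ⁻²≈ = 𝓛.trans (X-pos≈X-pos-suc⊗y (2 ℕ.+ m))
        (𝓛.trans (⊗-congʳ y (X-pos≈X-pos-suc⊗y (3 ℕ.+ m))) (𝓛.*-assoc ρᴸ y y))

  -1≤ord-x : -[1+ 0 ] ≤ord x
  -1≤ord-x = -≤+ ∷ ℤ.≤-refl ∷ []

  -1≤ord-Y : -[1+ 0 ] ≤ord Y
  -1≤ord-Y = ℤ.≤-refl ∷ -≤+ ∷ []

  ord-V : ∀ h → ℤ.- + suc h ≤ord V h
  ord-V zero          = ≡.subst (-[1+ 0 ] ≤ord_) (≡.sym V-0) -1≤ord-Y
  ord-V (suc zero)    = ≡.subst (-[1+ 1 ] ≤ord_) (≡.sym V-1) (≤ord-⊗ -1≤ord-x (ord-V zero))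
  ord-V (suc (suc h)) = ≡.subst (-[1+ suc (suc h) ] ≤ord_) (≡.sym (V-suc-suc h))
    (≤ord-⊖ (≤ord-⊗ -1≤ord-x (ord-V (suc h)))
            (≤ord-weaken (-≤- (ℕ.m≤n+m h 2)) (≤ord-⊗ {a = + 0} (ℤ.≤-refl ∷ []) (ord-V h))))

  CT : LPoly → Series → K
  CT p S = (p ∙ S) (+ 0)

  CT-cong : ∀ {p q} S → p ∼ q → CT p S ≈ CT q S
  CT-cong S p∼q = ∙-∼ p∼q S (+ 0)

  CT-Vᵇ : ∀ k S → CT (Vᵇ k) S ≈ (C̄ ∙ S) (+ 0 ℤ.- ℤ.- + k) - (C ∙ S) (+ 0 ℤ.- + k)
  CT-Vᵇ k S = trans (⊖-∙ (C̄ ⊗ X (ℤ.- + k)) (C ⊗ X (+ k)) S (+ 0))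
                    (+-cong (shifted C̄ (ℤ.- + k)) (-‿cong (shifted C (+ k))))
    where
    shifted : ∀ p e → ((p ⊗ X e) ∙ S) (+ 0) ≈ (p ∙ S) (+ 0 ℤ.- e)
    shifted p e = trans (∙-∼ (𝓛.*-comm p (X e)) S (+ 0)) (trans (⊗-∙ (X e) p S (+ 0)) (X-∙ e (p ∙ S) (+ 0)))

  -- C̄ G = Ā, and C G has no terms below ρ⁻²
  CT-Vᵇ-G : ∀ j → CT (Vᵇ (2 ℕ.+ j)) G ≈ 0#
  CT-Vᵇ-G zero = begin
    CT (Vᵇ 2) G                       ≈⟨ CT-Vᵇ 2 G ⟩
    (C̄ ∙ G) (+ 2) - (C ∙ G) -[1+ 1 ]  ≈⟨ +-cong (trans (G.∙-quotient (+ 2)) coeffP-Ā-2) (-‿cong C∙G) ⟩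
    - κ̂₂ - - κ̂₂                      ≈⟨ -‿inverseʳ _ ⟩
    0#                                ∎
    where
    C∙G : (C ∙ G) -[1+ 1 ] ≈ - κ̂₂
    C∙G = trans (+-cong (*-congˡ (G-vanishesBelow -[1+ 2 ] -<+))
                        (+-cong (*-congˡ (G-vanishesBelow -[1+ 0 ] -<+)) (+-congʳ (*-congˡ G-1))))
                (KS.solve 2 (λ s k → con (+ 1) :* con (+ 0) :+ (:- s :* con (+ 0) :+ (:- k :* con (+ 1) :+ con (+ 0))) := :- k)
                            refl (κ̂₁ + κ̂₂) κ̂₂)
      where open KS
  CT-Vᵇ-G (suc j) = begin
    CT (Vᵇ (3 ℕ.+ j)) G                               ≈⟨ CT-Vᵇ (3 ℕ.+ j) G ⟩
    (C̄ ∙ G) (+ (3 ℕ.+ j)) - (C ∙ G) -[1+ 2 ℕ.+ j ]    ≈⟨ +-cong (trans (G.∙-quotient (+ (3 ℕ.+ j))) (coeffP-Ā-3+ j))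
                                                                (-‿cong (∙-vanishesBelow C -3≤ord-C G-vanishesBelow _ (-<- (ℕ.s≤s (ℕ.s≤s ℕ.z≤n))))) ⟩
    0# - 0#                                           ≈⟨ -‿inverseʳ 0# ⟩
    0#                                                ∎

  CT-V-L-G : CT (V L) G ≈ 0#
  CT-V-L-G = begin
    CT (V L) G
      ≈⟨ CT-cong G V-L≈ ⟩
    CT ((Vᵇ L ⊕ Vᵇ (2 ℕ.+ m)) ⊖ const w ⊗ Vᵇ (2 ℕ.+ m)) G
      ≈⟨ ⊖-∙ (Vᵇ L ⊕ Vᵇ (2 ℕ.+ m)) (const w ⊗ Vᵇ (2 ℕ.+ m)) G (+ 0) ⟩
    CT (Vᵇ L ⊕ Vᵇ (2 ℕ.+ m)) G - CT (const w ⊗ Vᵇ (2 ℕ.+ m)) G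
      ≈⟨ +-cong (⊕-∙ (Vᵇ L) (Vᵇ (2 ℕ.+ m)) G (+ 0))
                (-‿cong (trans (⊗-∙ (const w) (Vᵇ (2 ℕ.+ m)) G (+ 0)) (const-∙ w (Vᵇ (2 ℕ.+ m) ∙ G) (+ 0)))) ⟩
    (CT (Vᵇ L) G + CT (Vᵇ (2 ℕ.+ m)) G) - w * CT (Vᵇ (2 ℕ.+ m)) G
      ≈⟨ +-cong (+-cong (CT-Vᵇ-G (2 ℕ.+ m)) (CT-Vᵇ-G m)) (-‿cong (*-congˡ (CT-Vᵇ-G m))) ⟩
    (0# + 0#) - w * 0#
      ≈⟨ KS.solve 1 (λ w → (con (+ 0) :+ con (+ 0)) :- w :* con (+ 0) := con (+ 0)) refl w ⟩
    0# ∎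
    where
    open KS using (solve; con; _:+_; _:-_; _:*_; _:=_)
    w = d (3 ℕ.+ m)
    V-L≈ : V L ∼ (Vᵇ L ⊕ Vᵇ (2 ℕ.+ m)) ⊖ const w ⊗ Vᵇ (2 ℕ.+ m)
    V-L≈ = 𝓛.trans (𝓛.reflexive (V-suc-suc (2 ℕ.+ m))) (⊖-cong (𝓛.trans (⊗-congˡ x (V≈Vᵇ (suc m) ℕ.≤-refl)) (Vᵇ-recurrence (2 ℕ.+ m)))
                  (⊗-congˡ (const w) (V≈Vᵇ m (ℕ.n≤1+n m))))

  CT-V-G : ∀ h → h ℕ.≤ L → CT (V h) G ≈ δ₀ h
  CT-V-G zero _ = trans (CT-cong G (𝓛.reflexive V-0)) (trans (+-cong (*-congˡ G-1) (+-congʳ (*-congˡ (G-vanishesBelow -[1+ 0 ] -<+))))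
    (KS.solve 0 (con (+ 1) :* con (+ 1) :+ (:- con (+ 1) :* con (+ 0) :+ con (+ 0)) := con (+ 1)) refl))
    where open KS
  CT-V-G (suc zero) _ = trans (CT-cong G V-1≈) (trans
    (+-cong (*-congˡ G-0) (+-cong (*-congˡ (G-vanishesBelow -[1+ 1 ] -<+)) (+-cong (*-congˡ G-2) (+-congʳ (*-congˡ G-0)))))
    (KS.solve 4 (λ a b c e → a :* con (+ 0) :+ (b :* con (+ 0) :+ (c :* con (+ 0) :+ (e :* con (+ 0) :+ con (+ 0))))
                             := con (+ 0)) refl _ _ _ _))
    where
    open KS
    G-0 : G (+ 0) ≈ 0#
    G-0 = G-vanishesBelow (+ 0) (+<+ (ℕ.s≤s ℕ.z≤n))
  CT-V-G (suc (suc j)) 2+j≤L with j ℕ.≟ 2 ℕ.+ m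
  ... | yes ≡.refl = CT-V-L-G
  ... | no j≢2+m   = trans (CT-cong G (V≈Vᵇ j j≤1+m)) (CT-Vᵇ-G j)
    where
    j≤1+m : j ℕ.≤ suc m
    j≤1+m = ℕ.≤-pred (ℕ.≤∧≢⇒< (ℕ.≤-pred (ℕ.≤-pred 2+j≤L)) j≢2+m)

  -- L ≥ 4 is needed exactly here: 2L - 2 > L + 1.
  CT-V-F : ∀ h → h ℕ.≤ L → CT (V h) F ≈ δ₀ h
  CT-V-F h h≤L = begin
    CT (V h) F                       ≈⟨ KS.solve 2 (λ p q → p := (p :- q) :+ q) refl (CT (V h) F) (CT (V h) G) ⟩
    (CT (V h) F - CT (V h) G) + CT (V h) G
      ≈⟨ +-congʳ (sym (∙-sub (V h) F G (+ 0))) ⟩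
    (V h ∙ (λ k → F k - G k)) (+ 0) + CT (V h) G
      ≈⟨ +-cong (∙-vanishesBelow (V h) -L-1≤ord-V F-G-vanishesBelow (+ 0) 0<L-3) (CT-V-G h h≤L) ⟩
    0# + δ₀ h                        ≈⟨ +-identityˡ _ ⟩
    δ₀ h                             ∎
    where
    open KS using (solve; _:=_; _:-_; _:+_)
    -L-1≤ord-V : ℤ.- + suc L ≤ord V h
    -L-1≤ord-V = ≤ord-weaken (ℤ.neg-mono-≤ (+≤+ (ℕ.s≤s h≤L))) (ord-V h)
    bound : ∀ z → -[1+ 5 ] ℤ.- ((-[1+ 0 ] ℤ.+ (-[1+ 0 ] ℤ.+ ℤ.- z)) ℤ.+ (-[1+ 0 ] ℤ.+ (-[1+ 0 ] ℤ.+ ℤ.- z)))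
                    ℤ.+ ℤ.- (+ 1 ℤ.+ z) ≡ z ℤ.- + 3
    bound = solve-∀
    0<L-3 : + 0 < -[1+ 5 ] ℤ.- (ord-D ℤ.+ ord-D) ℤ.+ ℤ.- + suc L
    0<L-3 = ℤ.<-≤-trans (+<+ (ℕ.s≤s ℕ.z≤n)) (ℤ.≤-reflexive (≡.sym (bound (+ L))))

  -- u n h = CT[xⁿ V h F] is the weight of the paths of length n from h to 0

  xⁿ : ℕ → LPoly
  xⁿ = D.pow R x

  u : ℕ → ℕ → K
  u n h = CT (xⁿ n ⊗ V h) F

  u-0 : ∀ h → h ℕ.≤ L → u 0 h ≈ δ₀ h
  u-0 h h≤L = trans (CT-cong F (𝓛.*-identityˡ (V h))) (CT-V-F h h≤L)

  u-suc : ∀ n h → u (suc n) h ≈ CT (xⁿ n ⊗ (x ⊗ V h)) F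
  u-suc n h = CT-cong F (𝓛S.solve 3 (λ x p v → (x :* p) :* v := p :* (x :* v)) 𝓛.refl x (xⁿ n) (V h))
    where open 𝓛S using (_:*_; _:=_)

  u-from-bottom : ∀ n → u (suc n) 0 ≈ u n 1
  u-from-bottom n = trans (u-suc n 0) (CT-cong F (⊗-congˡ (xⁿ n) (𝓛.reflexive (≡.sym V-1))))

  u-from-above : ∀ n h → u (suc n) (suc h) ≈ u n (suc (suc h)) + d (suc h) * u n h
  u-from-above n h = begin
    u (suc n) (suc h)
      ≈⟨ u-suc n (suc h) ⟩
    CT (xⁿ n ⊗ (x ⊗ V (suc h))) F
      ≈⟨ CT-cong F (𝓛S.solve 4 (λ p a w v → p :* a := p :* (a :- w :* v) :+ w :* (p :* v)) 𝓛.refl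
                               (xⁿ n) (x ⊗ V (suc h)) (const (d (suc h))) (V h)) ⟩
    CT (xⁿ n ⊗ (x ⊗ V (suc h) ⊖ const (d (suc h)) ⊗ V h) ⊕ const (d (suc h)) ⊗ (xⁿ n ⊗ V h)) F
      ≈⟨ CT-cong F (𝓛.+-congʳ (⊗-congˡ (xⁿ n) (𝓛.reflexive (≡.sym (V-suc-suc h))))) ⟩
    CT (xⁿ n ⊗ V (suc (suc h)) ⊕ const (d (suc h)) ⊗ (xⁿ n ⊗ V h)) F
      ≈⟨ ⊕-∙ (xⁿ n ⊗ V (suc (suc h))) (const (d (suc h)) ⊗ (xⁿ n ⊗ V h)) F (+ 0) ⟩
    u n (suc (suc h)) + CT (const (d (suc h)) ⊗ (xⁿ n ⊗ V h)) F
      ≈⟨ +-congˡ (trans (⊗-∙ (const (d (suc h))) (xⁿ n ⊗ V h) F (+ 0)) (const-∙ (d (suc h)) ((xⁿ n ⊗ V h) ∙ F) (+ 0))) ⟩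
    u n (suc (suc h)) + d (suc h) * u n h ∎
    where open 𝓛S using (_:*_; _:+_; _:-_; _:=_)

  reflect-xⁿ : ∀ n → reflect (xⁿ n) ∼ xⁿ n
  reflect-xⁿ zero    = 𝓛.refl
  reflect-xⁿ (suc n) = 𝓛.trans (reflect-⊗ x (xⁿ n)) (𝓛.*-cong (𝓛.+-comm y r) (reflect-xⁿ n))

  CT-xⁿ-M : ∀ n → coeffP (xⁿ n ⊗ M) (+ 0) ≈ 0#
  CT-xⁿ-M n = trans (coeffP-cong (⊗-congˡ (xⁿ n) M≈) (+ 0))
                    (coeffP-symmetric-⊗-antisymmetric (xⁿ n) (A ⊗ (B ⊗ ρᴸ)) (reflect-xⁿ n))
    where
    M≈ : M ∼ A ⊗ (B ⊗ ρᴸ) ⊖ reflect (A ⊗ (B ⊗ ρᴸ))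
    M≈ = ⊖-congˡ (A ⊗ (B ⊗ ρᴸ)) (𝓛.sym (𝓛.trans (reflect-⊗ A (B ⊗ ρᴸ)) (⊗-congˡ Ā (reflect-⊗ B ρᴸ))))

  u-beyond-top : ∀ n → u n (suc L) ≈ 0#
  u-beyond-top n = begin
    u n (suc L)                          ≈⟨ CT-cong F (⊗-congˡ (xⁿ n) V-top) ⟩
    CT (xⁿ n ⊗ ⊝ denominator) F          ≈⟨ CT-cong F (𝓛S.solve 2 (λ p q → p :* (:- q) := :- (p :* q)) 𝓛.refl (xⁿ n) denominator) ⟩
    CT (⊝ (xⁿ n ⊗ denominator)) F        ≈⟨ ⊝-∙ (xⁿ n ⊗ denominator) F (+ 0) ⟩
    - CT (xⁿ n ⊗ denominator) F          ≈⟨ -‿cong (∙-expansion-⊗ (xⁿ n) denominator F M F.∙-quotient (+ 0)) ⟩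
    - coeffP (xⁿ n ⊗ M) (+ 0)            ≈⟨ -‿cong (CT-xⁿ-M n) ⟩
    - 0#                                 ≈⟨ -0#≈0# ⟩
    0#                                   ∎
    where open 𝓛S using (_:*_; :-_; _:=_)

  u-step-top : ∀ n → u n (3 ℕ.+ m) ≈ W n (3 ℕ.+ m) → u (suc n) L ≈ W (suc n) L
  u-step-top n IH = begin
    u (suc n) L                                 ≈⟨ u-from-above n (3 ℕ.+ m) ⟩
    u n (suc L) + d L * u n (3 ℕ.+ m)           ≈⟨ +-cong (u-beyond-top n) (*-congˡ IH) ⟩
    0# + d L * W n (3 ℕ.+ m)                    ≈⟨ +-identityˡ _ ⟩
    d L * W n (3 ℕ.+ m)                         ≈⟨ sym (W-from-top n (3 ℕ.+ m) ≡.refl) ⟩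
    W (suc n) L                                 ∎

  u-step-interior : ∀ n h → suc h ℕ.< L → u n (suc (suc h)) ≈ W n (suc (suc h)) → u n h ≈ W n h →
                    u (suc n) (suc h) ≈ W (suc n) (suc h)
  u-step-interior n h 1+h<L IH₊ IH₋ = begin
    u (suc n) (suc h)                           ≈⟨ u-from-above n h ⟩
    u n (suc (suc h)) + d (suc h) * u n h       ≈⟨ +-cong IH₊ (*-congˡ IH₋) ⟩
    W n (suc (suc h)) + d (suc h) * W n h       ≈⟨ sym (W-from-interior n h 1+h<L) ⟩
    W (suc n) (suc h)                           ∎

  u-step-bottom : ∀ n → u n 1 ≈ W n 1 → u (suc n) 0 ≈ W (suc n) 0
  u-step-bottom n IH = begin
    u (suc n) 0   ≈⟨ u-from-bottom n ⟩
    u n 1         ≈⟨ IH ⟩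
    W n 1         ≈⟨ sym (W-from-bottom n (ℕ.s≤s ℕ.z≤n)) ⟩
    W (suc n) 0   ∎

  u≈W : ∀ n h → h ℕ.≤ L → u n h ≈ W n h
  u≈W-suc : ∀ n h → suc h ℕ.≤ L → suc h ℕ.< L ⊎ suc h ≡ L → u (suc n) (suc h) ≈ W (suc n) (suc h)
  u≈W zero    h       h≤L = trans (u-0 h h≤L) (sym (W-0 h))
  u≈W (suc n) zero    _   = u-step-bottom n (u≈W n 1 (ℕ.s≤s ℕ.z≤n))
  u≈W (suc n) (suc h) h<L = u≈W-suc n h h<L (ℕ.m≤n⇒m<n∨m≡n h<L)
  u≈W-suc n h h<L (inj₁ 1+h<L) = u-step-interior n h 1+h<L (u≈W n (suc (suc h)) 1+h<L) (u≈W n h (ℕ.<⇒≤ h<L))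
  u≈W-suc n h h<L (inj₂ 1+h≡L) = ≡.subst (λ k → u (suc n) k ≈ W (suc n) k) (≡.sym 1+h≡L)
    (u-step-top n (≡.subst (λ k → u n k ≈ W n k) (ℕ.suc-injective 1+h≡L) (u≈W n h (ℕ.<⇒≤ h<L))))

  ord-xⁿ : ∀ k → ℤ.- + k ≤ord xⁿ k
  ord-xⁿ zero    = ℤ.≤-refl ∷ []
  ord-xⁿ (suc k) = ≤ord-weaken (ℤ.≤-reflexive (-1-k k)) (≤ord-⊗ -1≤ord-x (ord-xⁿ k))
    where
    -1-k : ∀ k → ℤ.- + suc k ≡ -[1+ 0 ] ℤ.+ ℤ.- + k
    -1-k zero    = ≡.refl
    -1-k (suc k) = ≡.refl

  module _ (r : ℕ) where

    T : Series
    T = (xⁿ (2 ℕ.* r) ⊗ Y) ∙ F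

    T-expansion : D.ExpansionOf R (numerator r) denominator T
    T-expansion = (_ , ∙-vanishesBelow (xⁿ (2 ℕ.* r) ⊗ Y) (≤ord-⊗ (ord-xⁿ (2 ℕ.* r)) -1≤ord-Y) F.quotient-vanishesBelow)
                , λ n → begin
      (denominator ∙ ((xⁿ (2 ℕ.* r) ⊗ Y) ∙ F)) n
        ≈⟨ sym (⊗-∙ denominator (xⁿ (2 ℕ.* r) ⊗ Y) F n) ⟩
      ((denominator ⊗ (xⁿ (2 ℕ.* r) ⊗ Y)) ∙ F) n
        ≈⟨ ∙-∼ (𝓛.*-comm denominator (xⁿ (2 ℕ.* r) ⊗ Y)) F n ⟩
      (((xⁿ (2 ℕ.* r) ⊗ Y) ⊗ denominator) ∙ F) n
        ≈⟨ ∙-expansion-⊗ (xⁿ (2 ℕ.* r) ⊗ Y) denominator F M F.∙-quotient n ⟩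
      coeffP ((xⁿ (2 ℕ.* r) ⊗ Y) ⊗ M) n
        ≈⟨ coeffP-cong (𝓛S.solve 3 (λ p y q → (p :* y) :* q := (p :* q) :* y) 𝓛.refl (xⁿ (2 ℕ.* r)) Y M) n ⟩
      coeffP (numerator r) n ∎
      where open 𝓛S using (_:*_; _:=_)

    T-CT : T (+ 0) ≈ D.Z R (2 ℕ.* r) L κ₁ κ₂ ω₁ ω₂
    T-CT = trans (CT-cong F (⊗-congˡ (xⁿ (2 ℕ.* r)) (𝓛.reflexive (≡.sym V-0)))) (u≈W (2 ℕ.* r) 0 ℕ.z≤n)

    T-unique : ∀ S → D.ExpansionOf R (numerator r) denominator S → S (+ 0) ≈ T (+ 0)
    T-unique S (S-laurent , D∙S≈N) =
      ∙-injective denominator ord-D≤ord-denominator denominator-unit S-laurent (proj₁ T-expansion)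
                  (λ n → trans (D∙S≈N n) (sym (proj₂ T-expansion n))) (+ 0)

    CT-rhs : D.CTIs R (numerator r) denominator (D.Z R (2 ℕ.* r) L κ₁ κ₂ ω₁ ω₂)
    CT-rhs = (T , T-expansion , T-CT) , λ S S-expansion → trans (T-unique S S-expansion) T-CT

open import Defs using (CTIs; Z; module Thm6)
open import Data.Nat using (_≤_; _*_; s≤s; z≤n)

theorem6 : ∀ {c ℓ} (R : CommutativeRing c ℓ) (L r : ℕ) → 4 ≤ L →
    (κ₁ κ₂ ω₁ ω₂ : CommutativeRing.Carrier R) →
    CTIs R (Thm6.numerator R L κ₁ κ₂ ω₁ ω₂ r) (Thm6.denominator R L κ₁ κ₂ ω₁ ω₂)
      (Z R (2 * r) L κ₁ κ₂ ω₁ ω₂)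
theorem6 R .(suc (suc (suc (suc m)))) r (s≤s (s≤s (s≤s (s≤s {n = m} z≤n)))) κ₁ κ₂ ω₁ ω₂ =
  Theorem6Proof.CT-rhs R m κ₁ κ₂ ω₁ ω₂ r
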